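{- For every parameter $\kappa\in\{\mathrm{tw},\mathrm{fvs},\mathrm{fn},\mathrm{vc},\mathrm{tcw},\mathrm{stcw},\mathrm{fen}\}$ there exists a family of instances $(G_i,\mathcal{T}_i,d_i)_{i\in\mathbb{N}}$ of Generalized Steiner Tree Packing such that $\{\kappa((G_i)^{\mathcal{T}_i}_{\mathrm{vert}})\}_{i\in\mathbb{N}}$ is bounded while $\{\kappa((G_i)^{\mathcal{T}_i}_{\mathrm{clique}})\}_{i\in\mathbb{N}}$ is unbounded.
   Context: An instance of Generalized Steiner Tree Packing is a triple $(G,\mathcal{T},d)$ where $G$ is a simple undirected graph, $\mathcal{T}\subseteq 2^{V(G)}$ and $d\colon\mathcal{T}\to\mathbb{N}^+$. The clique-augmented graph $G^{\mathcal{T}}_{\mathrm{clique}}$ is the multigraph obtained from $G$ by adding, for every $T\in\mathcal{T}$ and every pair of distinct $u,v\in T$, a new edge $uv$ (possibly parallel to existing ones). The vertex-augmented graph $G^{\mathcal{T}}_{\mathrm{vert}}$ is obtained from $G$ by adding, for every $T\in\mathcal{T}$, a new vertex adjacent to exactly the vertices of $T$. The parameters are: treewidth $\mathrm{tw}$, feedback vertex set number $\mathrm{fvs}$, fracture number $\mathrm{fn}$ (minimum size of a set $S$ such that every component of the graph minus $S$ has at most $|S|$ vertices), vertex cover number $\mathrm{vc}$, tree-cut width $\mathrm{tcw}$ (Wollan), slim tree-cut width $\mathrm{stcw}$ (Ganian–Korchemna), and feedback edge set number $\mathrm{fen}$ (minimum number of edges whose deletion leaves a forest), each in its standard sense on multigraphs.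 -}

module Defs where

open import Data.Nat using (ℕ; zero; suc; _+_; _≤_; _<_)
open import Data.Bool using (Bool; true; false; if_then_else_; _∧_; _∨_; not)
open import Data.Fin using (Fin; zero; suc; inject₁; fromℕ; _↑ˡ_; _↑ʳ_; splitAt; toℕ)
open import Data.Fin.Properties using (_≟_)
open import Data.Fin.Subset using (Subset; _∈_; _∉_; ∣_∣; ∁; ⁅_⁆; _-_)
  renaming (⊥ to ∅)
open import Data.List using (List; []; _∷_; length; lookup; _++_; map; concatMap; allFin)
open import Data.Bool.ListAction using (any)
open import Data.List.Relation.Unary.All using (All)
open import Data.List.Relation.Unary.Unique.Propositional using (Unique)
open import Data.List.Relation.Binary.Permutation.Propositional using (_↭_)
open import Data.Vec using (tabulate)
import Data.Vec as Vec
open import Data.Product using (Σ; ∃; _×_; _,_; proj₁; proj₂)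
open import Data.Sum using (_⊎_; [_,_])
open import Data.Empty using (⊥)
open import Function using (_∘_; const)
open import Function.Definitions using (Injective)
open import Relation.Nullary using (¬_)
open import Relation.Nullary.Decidable using (⌊_⌋)
open import Relation.Binary.PropositionalEquality using (_≡_; _≢_)
open import Relation.Binary.Construct.Closure.ReflexiveTransitive using (Star)

-- Finite multigraphs: vertex set Fin n, edges a list of (ordered
-- representations of) unordered pairs; parallel edges = repeated
-- entries.  Edges are indexed by Fin (length E).

record MG : Set where
  constructor mg
  field
    n : ℕ
    E : List (Fin n × Fin n)
open MG public

EdgeIx : MG → Set
EdgeIx H = Fin (length (E H))

Joins : ∀ {n} → Fin n × Fin n → Fin n → Fin n → Set
Joins (a , b) x y = (a ≡ x × b ≡ y) ⊎ (a ≡ y × b ≡ x)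

data Reach (H : MG) (F : Subset (n H)) (u : Fin (n H)) : Fin (n H) → Set where
  here : u ∉ F → Reach H F u u
  step : ∀ {w x} → Reach H F u w → (e : EdgeIx H) →
         Joins (lookup (E H) e) w x → x ∉ F → Reach H F u x

record Cycle (H : MG) (F : Subset (n H)) (D : Subset (length (E H))) : Set where
  field
    k    : ℕ
    vs   : Fin (suc k) → Fin (n H)
    es   : Fin (suc k) → EdgeIx H
    vinj : Injective _≡_ _≡_ vs
    einj : Injective _≡_ _≡_ es
    path : ∀ (i : Fin k) → Joins (lookup (E H) (es (inject₁ i))) (vs (inject₁ i)) (vs (suc i))
    close : Joins (lookup (E H) (es (fromℕ k))) (vs (fromℕ k)) (vs zero)
    vavoid : ∀ i → vs i ∉ F
    eavoid : ∀ i → es i ∉ D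

IsTree : MG → Set
IsTree T = (1 ≤ n T) × (∀ u v → Reach T ∅ u v) × ¬ Cycle T ∅ ∅

-- Parameters (as "κ(H) ≤ k" predicates)

VC≤ : MG → ℕ → Set
VC≤ H k = Σ (Subset (n H)) λ S → (∣ S ∣ ≤ k) ×
  (∀ (e : EdgeIx H) → (proj₁ (lookup (E H) e) ∈ S) ⊎ (proj₂ (lookup (E H) e) ∈ S))

FVS≤ : MG → ℕ → Set
FVS≤ H k = Σ (Subset (n H)) λ S → (∣ S ∣ ≤ k) × ¬ Cycle H S ∅

FEN≤ : MG → ℕ → Set
FEN≤ H k = Σ (Subset (length (E H))) λ D → (∣ D ∣ ≤ k) × ¬ Cycle H ∅ D

FN≤ : MG → ℕ → Set
FN≤ H k = Σ (Subset (n H)) λ S → (∣ S ∣ ≤ k) ×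
  (∀ v → v ∉ S → ∀ (C : Subset (n H)) → (∀ w → w ∈ C → Reach H S v w) → ∣ C ∣ ≤ ∣ S ∣)

record TreeDecomp (H : MG) : Set where
  field
    T      : MG
    tree   : IsTree T
    B      : Fin (n T) → Subset (n H)
    vcover : ∀ v → ∃ λ b → v ∈ B b
    ecover : ∀ (e : EdgeIx H) → ∃ λ b →
               (proj₁ (lookup (E H) e) ∈ B b) × (proj₂ (lookup (E H) e) ∈ B b)
    conn   : ∀ v a b → v ∈ B a → v ∈ B b →
               Reach T (∁ (tabulate λ c → Vec.lookup (B c) v)) a b

TW≤ : MG → ℕ → Set
TW≤ H k = Σ (TreeDecomp H) λ D → ∀ b → ∣ TreeDecomp.B D b ∣ ≤ suc k

-- Tree-cut decompositions (Wollan), following the formulation of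
-- Ganian–Kim–Szeider (torso, consolidation, 3-center).

record TreeCutDecomp (H : MG) : Set where
  field
    T    : MG
    tree : IsTree T
    X    : Fin (n T) → Subset (n H)
    part : ∀ v → ∃ λ b → v ∈ X b
    disj : ∀ v b b' → v ∈ X b → v ∈ X b' → b ≡ b'

module _ {H : MG} (D : TreeCutDecomp H) where
  open TreeCutDecomp D

  -- edge (a , c) of H crosses the tree edge pq (bags of the two
  -- components of T - pq; the q-side is what q reaches avoiding p)
  Crosses : Fin (n T) → Fin (n T) → Fin (n H) × Fin (n H) → Set
  Crosses p q (a , c) = ∃ λ b₁ → ∃ λ b₂ → (a ∈ X b₁) × (c ∈ X b₂) ×
    ((Reach T ⁅ q ⁆ p b₁ × Reach T ⁅ p ⁆ q b₂) ⊎ (Reach T ⁅ q ⁆ p b₂ × Reach T ⁅ p ⁆ q b₁))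

  AdhLE : EdgeIx T → ℕ → Set
  AdhLE f k = ∀ (A : Subset (length (E H))) →
    (∀ e → e ∈ A → Crosses (proj₁ (lookup (E T) f)) (proj₂ (lookup (E T) f)) (lookup (E H) e)) →
    ∣ A ∣ ≤ k

  AdjT : Fin (n T) → Fin (n T) → Set
  AdjT t u = ∃ λ (f : EdgeIx T) → Joins (lookup (E T) f) t u

  adjB : Fin (n T) → Fin (n T) → Bool
  adjB t u = any (λ e → (⌊ proj₁ e ≟ t ⌋ ∧ ⌊ proj₂ e ≟ u ⌋) ∨ (⌊ proj₁ e ≟ u ⌋ ∧ ⌊ proj₂ e ≟ t ⌋)) (E T)

  -- Torso at t: vertex set Fin (n H + n T); a vertex v of X t is
  -- v ↑ˡ n T, and the consolidated vertex z_i of the component T_i of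
  -- T - t is (n H) ↑ʳ u where u is the neighbour of t in T_i.
  -- φ is the consolidation map.
  IsConsol : Fin (n T) → (Fin (n H) → Fin (n H + n T)) → Set
  IsConsol t φ = ∀ v → (v ∈ X t → φ v ≡ v ↑ˡ n T) ×
    (∀ b → v ∈ X b → b ≢ t → ∃ λ u → AdjT t u × Reach T ⁅ t ⁆ u b × φ v ≡ n H ↑ʳ u)

  torsoAlive : Fin (n T) → Subset (n H + n T)
  torsoAlive t = tabulate λ w → [ Vec.lookup (X t) , adjB t ] (splitAt (n H) w)

  torsoProt : Fin (n T) → Subset (n H + n T)
  torsoProt t = tabulate λ w → [ Vec.lookup (X t) , const false ] (splitAt (n H) w)

  torsoE : Fin (n T) → (Fin (n H) → Fin (n H + n T)) →
           List (Fin (n H) × Fin (n H)) → List (Fin (n H + n T) × Fin (n H + n T))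
  torsoE t φ [] = []
  torsoE t φ ((a , c) ∷ es) =
    if not (Vec.lookup (X t) a) ∧ not (Vec.lookup (X t) c) ∧ ⌊ φ a ≟ φ c ⌋
    then torsoE t φ es
    else (φ a , φ c) ∷ torsoE t φ es

-- Suppression of unprotected vertices of degree ≤ thr (thr = 2 gives
-- the 3-center, thr = 1 the 2-center).  A state keeps a fixed vertex
-- universe Fin N with an "alive" subset.

record St (N : ℕ) : Set where
  constructor st
  field
    alive : Subset N
    es    : List (Fin N × Fin N)

Inc : ∀ {N} → Fin N → Fin N × Fin N → Set
Inc v (x , y) = (x ≡ v) ⊎ (y ≡ v)

NotInc : ∀ {N} → Fin N → List (Fin N × Fin N) → Set
NotInc v R = All (λ e → ¬ Inc v e) R

deg : ∀ {N} → Fin N → List (Fin N × Fin N) → ℕ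
deg v [] = 0
deg v ((x , y) ∷ es) =
  (if ⌊ x ≟ v ⌋ then 1 else 0) + (if ⌊ y ≟ v ⌋ then 1 else 0) + deg v es

data Supp {N : ℕ} (thr : ℕ) (P : Subset N) : St N → St N → Set where
  deg0 : ∀ {al es v} → v ∈ al → v ∉ P → NotInc v es →
         Supp thr P (st al es) (st (al - v) es)
  deg1 : ∀ {al es R e a v} → 1 ≤ thr → v ∈ al → v ∉ P →
         es ↭ (e ∷ R) → Joins e v a → a ≢ v → NotInc v R →
         Supp thr P (st al es) (st (al - v) R)
  deg2loop : ∀ {al es R v} → 2 ≤ thr → v ∈ al → v ∉ P →
         es ↭ ((v , v) ∷ R) → NotInc v R →
         Supp thr P (st al es) (st (al - v) R)
  deg2 : ∀ {al es R e₁ e₂ a b v} → 2 ≤ thr → v ∈ al → v ∉ P →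
         es ↭ (e₁ ∷ e₂ ∷ R) → Joins e₁ v a → a ≢ v → Joins e₂ v b → b ≢ v →
         NotInc v R →
         Supp thr P (st al es) (st (al - v) ((a , b) ∷ R))

Irreducible : ∀ {N} → ℕ → Subset N → St N → Set
Irreducible thr P s = ∀ v → v ∈ St.alive s → v ∉ P → thr < deg v (St.es s)

CenterLE : ∀ {N} → ℕ → Subset N → St N → ℕ → Set
CenterLE thr P s k = Σ (St _) λ s' →
  Star (Supp thr P) s s' × Irreducible thr P s' × ∣ St.alive s' ∣ ≤ k

module _ {H : MG} (D : TreeCutDecomp H) where
  open TreeCutDecomp D

  TorLE : ℕ → Fin (n T) → ℕ → Set
  TorLE thr t k = Σ (Fin (n H) → Fin (n H + n T)) λ φ → IsConsol D t φ ×
    CenterLE thr (torsoProt D t) (st (torsoAlive D t) (torsoE D t φ (E H))) k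

TCWthr≤ : ℕ → MG → ℕ → Set
TCWthr≤ thr H k = Σ (TreeCutDecomp H) λ D →
  (∀ f → AdhLE D f k) × (∀ t → TorLE D thr t k)

TCW≤ : MG → ℕ → Set
TCW≤ = TCWthr≤ 2

STCW≤ : MG → ℕ → Set
STCW≤ = TCWthr≤ 1

data Param : Set where
  tw fvs fn vc tcw stcw fen : Param

_≤ₚ_at_ : MG → ℕ → Param → Set
H ≤ₚ k at tw   = TW≤ H k
H ≤ₚ k at fvs  = FVS≤ H k
H ≤ₚ k at fn   = FN≤ H k
H ≤ₚ k at vc   = VC≤ H k
H ≤ₚ k at tcw  = TCW≤ H k
H ≤ₚ k at stcw = STCW≤ H k
H ≤ₚ k at fen  = FEN≤ H k

UPair : ∀ {n} → Fin n × Fin n → Fin n × Fin n → Set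
UPair (a , b) (c , d) = Joins (c , d) a b

record SimpleGraph : Set where
  field
    n     : ℕ
    E     : List (Fin n × Fin n)
    loopless : All (λ e → proj₁ e ≢ proj₂ e) E
    noParallel : ∀ (i j : Fin (length E)) → UPair (lookup E i) (lookup E j) → i ≡ j

record Instance : Set where
  field
    G  : SimpleGraph
    𝒯  : List (Subset (SimpleGraph.n G))
    𝒯-set : Unique 𝒯
    d  : Fin (length 𝒯) → ℕ
    d-pos : ∀ i → 1 ≤ d i

cliqueOn : ∀ {n} → Subset n → List (Fin n × Fin n)
cliqueOn {n} T = concatMap (λ u → concatMap (λ v →
  if Vec.lookup T u ∧ Vec.lookup T v ∧ ⌊ Data.Nat._<?_ (toℕ u) (toℕ v) ⌋
  then (u , v) ∷ [] else []) (allFin n)) (allFin n)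

cliqueAug : Instance → MG
cliqueAug I = mg (SimpleGraph.n G) (SimpleGraph.E G ++ concatMap cliqueOn 𝒯)
  where open Instance I

vertAug : Instance → MG
vertAug I = mg (nG + length 𝒯)
  (map (λ e → (proj₁ e ↑ˡ length 𝒯 , proj₂ e ↑ˡ length 𝒯)) (SimpleGraph.E G) ++
   concatMap (λ j → concatMap (λ u →
     if Vec.lookup (lookup 𝒯 j) u then (u ↑ˡ length 𝒯 , nG ↑ʳ j) ∷ [] else [])
     (allFin nG)) (allFin (length 𝒯)))
  where
    open Instance I
    nG = SimpleGraph.n G

{-# OPTIONS --safe #-}

-- The instance on m isolated vertices whose only terminal set is the whole vertex set has the star
-- K₁,ₘ as vertex-augmented graph and the complete graph Kₘ as clique-augmented graph.  The star is a
-- tree in which the centre alone covers every edge and separates the leaves, so all seven parameters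
-- are at most 1 on it.  On Kₘ they all grow with m: removing few vertices or edges leaves an edge or a
-- triangle (vc, fvs, fen) or a large component (fn); by the Helly property of subtrees some bag of a tree
-- decomposition holds the whole clique (tw); and a tree-cut decomposition either has a bag holding
-- every vertex, all of which survive in its torso, or a tree edge crossed by an edge from almost every
-- vertex (tcw, stcw).

module Submission where

open import Defs

open import Data.Bool using (Bool; true; false; if_then_else_; _∧_; _∨_) renaming (T to IsTrue)
open import Data.Bool.Properties using (T-≡; ∨-zeroʳ)
open import Data.Empty using (⊥; ⊥-elim)
open import Data.Fin using (Fin; zero; suc; toℕ; fromℕ; fromℕ<; inject₁; inject≤; punchIn; _↑ˡ_; _↑ʳ_; splitAt)
open import Data.Fin.Properties
  using ( any?; all?; ¬∀⟶∃¬; pigeonhole; injective⇒≤; <-cmp; suc-injective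
        ; toℕ-injective; toℕ<n; toℕ≤pred[n]; toℕ-fromℕ; toℕ-fromℕ<; toℕ-inject₁; inject≤-injective
        ; punchIn-injective; punchInᵢ≢i; ↑ˡ-injective; ↑ʳ-injective
        ; splitAt-↑ˡ; splitAt-↑ʳ; splitAt⁻¹-↑ˡ; splitAt⁻¹-↑ʳ )
  renaming (_≟_ to _≟ᶠ_)
open import Data.Fin.Subset using (Subset; _∈_; _∉_; _⊆_; ∣_∣; ⁅_⁆; ⊤; ∁; _-_; _─_; _∪_; inside; outside)
  renaming (⊥ to ∅)
open import Data.Fin.Subset.Properties
  using ( _∈?_; x∈⁅x⁆; x∈⁅y⁆⇒x≡y; ∉⊥; x∈∁p⇒x∉p; x∉p⇒x∈∁p; x∈p⇒x∉∁p; x∈p∪q⁺; x∈p∪q⁻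
        ; x∈p∧x∉q⇒x∈p─q; p─q⊆p; p⊆q⇒∣p∣≤∣q∣; ∣⁅x⁆∣≡1; ∣⊥∣≡0; ∣∁p∣≡n∸∣p∣ )
open import Data.List using (List; []; _∷_; length; lookup; map; concatMap; allFin)
open import Data.List.Properties using (++-identityʳ)
open import Data.List.Membership.Propositional using () renaming (_∈_ to _∈ₗ_)
open import Data.List.Membership.Propositional.Properties using (∈-lookup; ∈-allFin; ∈-map⁺; ∈-map⁻; ∈-concatMap⁺)
open import Data.List.Relation.Binary.Permutation.Propositional using (↭-refl)
open import Data.List.Relation.Unary.All using (All; []; _∷_)
import Data.List.Relation.Unary.All as All
open import Data.List.Relation.Unary.AllPairs using ([]; _∷_)
open import Data.List.Relation.Unary.Any using (here; there)
import Data.List.Relation.Unary.Any as Any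
open import Data.List.Relation.Unary.Any.Properties using (lookup-index; any⁺)
open import Data.List.Relation.Unary.Unique.Propositional using (Unique)
open import Data.List.Relation.Unary.Unique.Propositional.Properties using (map⁺; allFin⁺)
open import Data.Nat using (ℕ; zero; suc; _+_; _≤_; _<_; z≤n; s≤s; _≟_; _<?_)
import Data.Nat.Properties as ℕ
open import Data.Product using (Σ; ∃; _×_; _,_; proj₁; proj₂)
open import Data.Sum using (_⊎_; inj₁; inj₂; [_,_])
open import Data.Vec.Base using ([]; _∷_; here; there)
import Data.Vec.Base as Vec
open import Data.Vec.Properties using (lookup-replicate; lookup∘tabulate; []=⇒lookup; lookup⇒[]=)
open import Function using (_∘_; _$_; id)
open import Function.Bundles using (Equivalence)
open import Function.Definitions using (Injective)
open import Relation.Binary using (tri<; tri≈; tri>)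
open import Relation.Binary.Construct.Closure.ReflexiveTransitive using (Star; ε; _◅_; _◅◅_)
open import Relation.Binary.PropositionalEquality using (_≡_; _≢_; refl; sym; trans; cong; subst)
open import Relation.Nullary using (¬_; yes; no; contradiction)
open import Relation.Nullary.Decidable using (⌊_⌋; _→-dec_; ¬?; isYes≗does; dec-true; toWitness)

-- Finite sets

rank : ∀ {n} (p : Subset n) {x} → x ∈ p → Fin ∣ p ∣
rank (inside ∷ p) here = zero
rank (inside ∷ p) (there x∈p) = suc (rank p x∈p)
rank (outside ∷ p) (there x∈p) = rank p x∈p

rank-injective : ∀ {n} (p : Subset n) {x y} (x∈p : x ∈ p) (y∈p : y ∈ p) →
                 rank p x∈p ≡ rank p y∈p → x ≡ y
rank-injective (inside ∷ p) here here _ = refl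
rank-injective (inside ∷ p) (there x∈p) (there y∈p) eq = cong suc (rank-injective p x∈p y∈p (suc-injective eq))
rank-injective (outside ∷ p) (there x∈p) (there y∈p) eq = cong suc (rank-injective p x∈p y∈p eq)

injective-into⇒≤∣p∣ : ∀ {k n} {p : Subset n} (h : Fin k → Fin n) → Injective _≡_ _≡_ h →
                       (∀ i → h i ∈ p) → k ≤ ∣ p ∣
injective-into⇒≤∣p∣ {p = p} h h-inj h∈p = injective⇒≤ (h-inj ∘ rank-injective p (h∈p _) (h∈p _))

∉⁅⁆ : ∀ {n} {x y : Fin n} → x ≢ y → x ∉ ⁅ y ⁆
∉⁅⁆ x≢y x∈⁅y⁆ = x≢y (x∈⁅y⁆⇒x≡y _ x∈⁅y⁆)

∣⁅x⁆∣≤1 : ∀ {n} (x : Fin n) → ∣ ⁅ x ⁆ ∣ ≤ 1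
∣⁅x⁆∣≤1 x = ℕ.≤-reflexive (∣⁅x⁆∣≡1 x)

∣p∪q∣≤∣p∣+∣q∣ : ∀ {n} (p q : Subset n) → ∣ p ∪ q ∣ ≤ ∣ p ∣ + ∣ q ∣
∣p∪q∣≤∣p∣+∣q∣ [] [] = z≤n
∣p∪q∣≤∣p∣+∣q∣ (inside ∷ p) (inside ∷ q) =
  s≤s (ℕ.≤-trans (∣p∪q∣≤∣p∣+∣q∣ p q) (ℕ.+-monoʳ-≤ ∣ p ∣ (ℕ.n≤1+n _)))
∣p∪q∣≤∣p∣+∣q∣ (inside ∷ p) (outside ∷ q) = s≤s (∣p∪q∣≤∣p∣+∣q∣ p q)
∣p∪q∣≤∣p∣+∣q∣ (outside ∷ p) (inside ∷ q) =
  subst (suc ∣ p ∪ q ∣ ≤_) (sym (ℕ.+-suc ∣ p ∣ ∣ q ∣)) (s≤s (∣p∪q∣≤∣p∣+∣q∣ p q))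
∣p∪q∣≤∣p∣+∣q∣ (outside ∷ p) (outside ∷ q) = ∣p∪q∣≤∣p∣+∣q∣ p q

x∈p─q⇒x∉q : ∀ {n} {p q : Subset n} {x} → x ∈ p ─ q → x ∉ q
x∈p─q⇒x∉q {p = inside ∷ _} {outside ∷ _} here ()
x∈p─q⇒x∉q {p = _ ∷ _} {_ ∷ _} (there x∈p─q) (there x∈q) = x∈p─q⇒x∉q x∈p─q x∈q

⌊x≟x⌋ : ∀ {n} (x : Fin n) → ⌊ x ≟ᶠ x ⌋ ≡ true
⌊x≟x⌋ x = trans (isYes≗does _) (dec-true (x ≟ᶠ x) refl)

lookup-⁅x⁆-x : ∀ {n} (x : Fin n) → Vec.lookup ⁅ x ⁆ x ≡ true
lookup-⁅x⁆-x x = []=⇒lookup (x∈⁅x⁆ x)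

lookup-⁅x⁆-y : ∀ {n} {x y : Fin n} → y ≢ x → Vec.lookup ⁅ x ⁆ y ≡ false
lookup-⁅x⁆-y {x = x} {y} y≢x with Vec.lookup ⁅ x ⁆ y in eq
... | true = contradiction (x∈⁅y⁆⇒x≡y x (lookup⇒[]= y _ eq)) y≢x
... | false = refl

∈-tabulate⁺ : ∀ {n} {f : Fin n → Bool} {x} → f x ≡ inside → x ∈ Vec.tabulate f
∈-tabulate⁺ {f = f} {x} fx≡inside = lookup⇒[]= x _ (trans (lookup∘tabulate f x) fx≡inside)

∈-tabulate⁻ : ∀ {n} {f : Fin n → Bool} {x} → x ∈ Vec.tabulate f → f x ≡ inside
∈-tabulate⁻ {f = f} {x} x∈ = trans (sym (lookup∘tabulate f x)) ([]=⇒lookup x∈)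

image : ∀ {k n} → (Fin k → Fin n) → Subset n
image h = Vec.tabulate λ x → ⌊ any? (λ i → h i ≟ᶠ x) ⌋

∈-image⁺ : ∀ {k n} (h : Fin k → Fin n) i → h i ∈ image h
∈-image⁺ h i = ∈-tabulate⁺ (trans (isYes≗does _) (dec-true (any? λ j → h j ≟ᶠ h i) (i , refl)))

∈-image⁻ : ∀ {k n} (h : Fin k → Fin n) {x} → x ∈ image h → ∃ λ i → h i ≡ x
∈-image⁻ h x∈ = toWitness (Equivalence.from T-≡ (∈-tabulate⁻ x∈))

module _ {N m : ℕ} (tag : Fin N → Fin m) (D : Subset N) where

  Untagged : Fin m → Set
  Untagged x = ∀ e → e ∈ D → tag e ≢ x

  private
    tagged-witness : ∀ x → ¬ Untagged x → ∃ λ e → e ∈ D × tag e ≡ x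
    tagged-witness x ¬untagged
      with ¬∀⟶∃¬ N _ (λ e → (e ∈? D) →-dec ¬? (tag e ≟ᶠ x)) ¬untagged
    ... | e , ¬ok with e ∈? D | tag e ≟ᶠ x
    ...   | yes e∈D | yes tag≡x = e , e∈D , tag≡x
    ...   | yes _   | no tag≢x = contradiction (λ _ → tag≢x) ¬ok
    ...   | no e∉D  | _ = contradiction (λ e∈D → contradiction e∈D e∉D) ¬ok

  untagged-among : ∀ {c} → ∣ D ∣ ≤ c → (g : Fin (suc c) → Fin m) → Injective _≡_ _≡_ g →
                   ∃ λ i → Untagged (g i)
  untagged-among D≤c g g-inj
    with any? (λ i → all? (λ e → (e ∈? D) →-dec ¬? (tag e ≟ᶠ g i)))
  ... | yes found = found
  ... | no none = contradiction (ℕ.≤-trans (injective-into⇒≤∣p∣ witness witness-inj witness∈D) D≤c) ℕ.1+n≰n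
    where
      tagged : ∀ i → ∃ λ e → e ∈ D × tag e ≡ g i
      tagged i = tagged-witness (g i) (λ untagged → none (i , untagged))
      witness : Fin (suc _) → Fin N
      witness i = proj₁ (tagged i)
      witness∈D : ∀ i → witness i ∈ D
      witness∈D i = proj₁ (proj₂ (tagged i))
      witness-inj : Injective _≡_ _≡_ witness
      witness-inj {i} {j} eq =
        g-inj (trans (sym (proj₂ (proj₂ (tagged i)))) (trans (cong tag eq) (proj₂ (proj₂ (tagged j)))))

  untagged-injection : ∀ {c} → ∣ D ∣ ≤ c → ∀ k (g : Fin (k + c) → Fin m) → Injective _≡_ _≡_ g →
                       ∃ λ (h : Fin k → Fin (k + c)) → Injective _≡_ _≡_ h × ∀ i → Untagged (g (h i))
  untagged-injection D≤c zero g g-inj = (λ ()) , (λ { {()} }) , λ ()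
  untagged-injection {c} D≤c (suc k) g g-inj = h′ , h′-inj , untagged-h′
    where
      first : Fin (suc c) → Fin (suc k + c)
      first i = inject≤ i (s≤s (ℕ.m≤n+m c k))
      picked : ∃ λ i → Untagged (g (first i))
      picked = untagged-among D≤c (g ∘ first) (inject≤-injective _ _ _ _ ∘ g-inj)
      a = first (proj₁ picked)
      rest : ∃ λ (h : Fin k → Fin (k + c)) → Injective _≡_ _≡_ h × ∀ i → Untagged (g (punchIn a (h i)))
      rest = untagged-injection D≤c k (g ∘ punchIn a) (punchIn-injective a _ _ ∘ g-inj)
      h = proj₁ rest
      h′ : Fin (suc k) → Fin (suc k + c)
      h′ zero = a
      h′ (suc j) = punchIn a (h j)
      h′-inj : Injective _≡_ _≡_ h′
      h′-inj {zero} {zero} _ = refl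
      h′-inj {zero} {suc j} eq = contradiction (sym eq) (punchInᵢ≢i a (h j))
      h′-inj {suc j} {zero} eq = contradiction eq (punchInᵢ≢i a (h j))
      h′-inj {suc j} {suc j′} eq = cong suc (proj₁ (proj₂ rest) (punchIn-injective a _ _ eq))
      untagged-h′ : ∀ j → Untagged (g (h′ j))
      untagged-h′ zero = proj₂ picked
      untagged-h′ (suc j) = proj₂ (proj₂ rest) j

untagged⇒∉ : ∀ {N m} {tag : Fin N → Fin m} {D x e} → Untagged tag D x → tag e ≡ x → e ∉ D
untagged⇒∉ untagged tag≡x e∈D = untagged _ e∈D tag≡x

untagged-either⇒∉ : ∀ {N m} {tag : Fin N → Fin m} {D x y e} → Untagged tag D x → Untagged tag D y →
               tag e ≡ x ⊎ tag e ≡ y → e ∉ D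
untagged-either⇒∉ untagged-x _ (inj₁ tag≡x) = untagged⇒∉ untagged-x tag≡x
untagged-either⇒∉ _ untagged-y (inj₂ tag≡y) = untagged⇒∉ untagged-y tag≡y

lookup-injective : ∀ {A : Set} {xs : List A} → Unique xs → ∀ i j → lookup xs i ≡ lookup xs j → i ≡ j
lookup-injective (_ ∷ _) zero zero _ = refl
lookup-injective (x∉xs ∷ _) zero (suc j) eq = contradiction eq (All.lookup x∉xs (∈-lookup j))
lookup-injective (x∉xs ∷ _) (suc i) zero eq = contradiction (sym eq) (All.lookup x∉xs (∈-lookup i))
lookup-injective (_ ∷ xs-unique) (suc i) (suc j) eq = cong suc (lookup-injective xs-unique i j eq)

-- Walks

joins-sym : ∀ {n} {e : Fin n × Fin n} {x y} → Joins e x y → Joins e y x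
joins-sym (inj₁ (a , b)) = inj₂ (a , b)
joins-sym (inj₂ (a , b)) = inj₁ (a , b)

joins-unique : ∀ {n} {e : Fin n × Fin n} {a b c d} → Joins e a b → Joins e c d →
               (a ≡ c × b ≡ d) ⊎ (a ≡ d × b ≡ c)
joins-unique (inj₁ (refl , refl)) (inj₁ (refl , refl)) = inj₁ (refl , refl)
joins-unique (inj₁ (refl , refl)) (inj₂ (refl , refl)) = inj₂ (refl , refl)
joins-unique (inj₂ (refl , refl)) (inj₁ (refl , refl)) = inj₂ (refl , refl)
joins-unique (inj₂ (refl , refl)) (inj₂ (refl , refl)) = inj₁ (refl , refl)

Adjacent : (H : MG) → Fin (n H) → Fin (n H) → Set
Adjacent H x y = ∃ λ (e : EdgeIx H) → Joins (lookup (E H) e) x y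

module _ {H : MG} where

  reach-target∉ : ∀ {F u v} → Reach H F u v → v ∉ F
  reach-target∉ (here v∉F) = v∉F
  reach-target∉ (step _ _ _ v∉F) = v∉F

  reach-prepend : ∀ {F x u v} (e : EdgeIx H) → Joins (lookup (E H) e) x u → x ∉ F →
                  Reach H F u v → Reach H F x v
  reach-prepend e j x∉F (here u∉F) = step (here x∉F) e j u∉F
  reach-prepend e j x∉F (step r e′ j′ v∉F) = step (reach-prepend e j x∉F r) e′ j′ v∉F

  reach-sym : ∀ {F u v} → Reach H F u v → Reach H F v u
  reach-sym (here u∉F) = here u∉F
  reach-sym (step r e j v∉F) = reach-prepend e (joins-sym j) v∉F (reach-sym r)

  reach-trans : ∀ {F a b c} → Reach H F a b → Reach H F b c → Reach H F a c
  reach-trans r (here _) = r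
  reach-trans r (step r′ e j c∉F) = step (reach-trans r r′) e j c∉F

  reach-mono : ∀ {F F′ u v} → F′ ⊆ F → Reach H F u v → Reach H F′ u v
  reach-mono F′⊆F (here u∉F) = here (u∉F ∘ F′⊆F)
  reach-mono F′⊆F (step r e j v∉F) = step (reach-mono F′⊆F r) e j (v∉F ∘ F′⊆F)

  reach-split : ∀ {F a b} z → Reach H F a b → Reach H ⁅ z ⁆ a b ⊎ Reach H F z b
  reach-split {a = a} z (here a∉F) with a ≟ᶠ z
  ... | yes refl = inj₂ (here a∉F)
  ... | no a≢z = inj₁ (here (∉⁅⁆ a≢z))
  reach-split z (step {x = x} r e j x∉F) with reach-split z r
  ... | inj₂ r′ = inj₂ (step r′ e j x∉F)
  ... | inj₁ r′ with x ≟ᶠ z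
  ...   | yes refl = inj₂ (here x∉F)
  ...   | no x≢z = inj₁ (step r′ e j (∉⁅⁆ x≢z))

  last-exit : ∀ {F b} t → Reach H F t b → t ≢ b → ∃ λ u → Adjacent H t u × u ≢ t × Reach H ⁅ t ⁆ u b
  last-exit t (here _) t≢t = contradiction refl t≢t
  last-exit {b = x} t (step {w = w} r e j _) t≢x with w ≟ᶠ t
  ... | yes refl = x , (e , j) , (t≢x ∘ sym) , here (∉⁅⁆ (t≢x ∘ sym))
  ... | no w≢t with last-exit t r (w≢t ∘ sym)
  ...   | u , edge , u≢t , r′ = u , edge , u≢t , step r′ e j (∉⁅⁆ (t≢x ∘ sym))

  reach-side : ∀ {F p q b} → p ≢ q → Reach H F p b → Reach H ⁅ q ⁆ p b ⊎ Reach H ⁅ p ⁆ q b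
  reach-side p≢q (here _) = inj₁ (here (∉⁅⁆ p≢q))
  reach-side {p = p} {q} p≢q (step {x = x} r e j _) with reach-side p≢q r
  ... | inj₁ r′ with x ≟ᶠ q
  ...   | yes refl = inj₂ (here (∉⁅⁆ (p≢q ∘ sym)))
  ...   | no x≢q = inj₁ (step r′ e j (∉⁅⁆ x≢q))
  reach-side {p = p} p≢q (step {x = x} r e j _) | inj₂ r′ with x ≟ᶠ p
  ...   | yes refl = inj₁ (here (∉⁅⁆ p≢q))
  ...   | no x≢p = inj₂ (step r′ e j (∉⁅⁆ x≢p))

joins-proj₁ : ∀ {n} {e : Fin n × Fin n} {x y} → Joins e x y → proj₁ e ≡ x ⊎ proj₁ e ≡ y
joins-proj₁ (inj₁ (p , _)) = inj₁ p
joins-proj₁ (inj₂ (p , _)) = inj₂ p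

joins-proj₂ : ∀ {n} {e : Fin n × Fin n} {x y} → Joins e x y → proj₂ e ≡ x ⊎ proj₂ e ≡ y
joins-proj₂ (inj₁ (_ , q)) = inj₂ q
joins-proj₂ (inj₂ (_ , q)) = inj₁ q

-- Trees

override : {A : Set} → ℕ → A → (ℕ → A) → ℕ → A
override k a g j with j ≟ k
... | yes _ = a
... | no _ = g j

override-at : {A : Set} (k : ℕ) (a : A) (g : ℕ → A) → override k a g k ≡ a
override-at k a g with k ≟ k
... | yes _ = refl
... | no k≢k = contradiction refl k≢k

override-elsewhere : {A : Set} {k j : ℕ} (a : A) (g : ℕ → A) → j ≢ k → override k a g j ≡ g j
override-elsewhere {k = k} {j} a g j≢k with j ≟ k
... | yes j≡k = contradiction j≡k j≢k
... | no _ = refl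

module _ {T : MG} (f : EdgeIx T) where

  record SimplePathAvoiding (p x : Fin (n T)) : Set where
    field
      len : ℕ
      vs : ℕ → Fin (n T)
      es : ℕ → EdgeIx T
      starts : vs 0 ≡ p
      ends : vs len ≡ x
      joins : ∀ i → i < len → Joins (lookup (E T) (es i)) (vs i) (vs (suc i))
      vs-inj : ∀ i j → i ≤ len → j ≤ len → vs i ≡ vs j → i ≡ j
      avoids : ∀ i → i < len → es i ≢ f

  open SimplePathAvoiding

  empty-path : ∀ p → SimplePathAvoiding p p
  empty-path p = record
    { len = 0 ; vs = λ _ → p ; es = λ _ → f ; starts = refl ; ends = refl ; joins = λ _ ()
    ; vs-inj = λ { _ _ z≤n z≤n _ → refl } ; avoids = λ _ () }

  truncate-path : ∀ {p w x} (P : SimplePathAvoiding p w) i → i ≤ len P → vs P i ≡ x → SimplePathAvoiding p x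
  truncate-path P i i≤len vsᵢ≡x = record
    { len = i ; vs = vs P ; es = es P ; starts = starts P ; ends = vsᵢ≡x
    ; joins = λ a a<i → joins P a (ℕ.<-≤-trans a<i i≤len)
    ; vs-inj = λ a b a≤i b≤i → vs-inj P a b (ℕ.≤-trans a≤i i≤len) (ℕ.≤-trans b≤i i≤len)
    ; avoids = λ a a<i → avoids P a (ℕ.<-≤-trans a<i i≤len) }

  append-edge : ∀ {p w x} (P : SimplePathAvoiding p w) (e : EdgeIx T) → Joins (lookup (E T) e) w x → e ≢ f →
                (∀ i → i ≤ len P → vs P i ≢ x) → SimplePathAvoiding p x
  append-edge {x = x} P e e-joins e≢f x∉P = record
    { len = suc k ; vs = vs′ ; es = es′
    ; starts = trans (vs′-old z≤n) (starts P) ; ends = override-at (suc k) x (vs P)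
    ; joins = joins′ ; vs-inj = vs′-inj ; avoids = avoids′ }
    where
      k = len P
      vs′ = override (suc k) x (vs P)
      es′ = override k e (es P)
      vs′-old : ∀ {i} → i ≤ k → vs′ i ≡ vs P i
      vs′-old i≤k = override-elsewhere x (vs P) (λ eq → ℕ.<-irrefl eq (s≤s i≤k))
      es′-old : ∀ {i} → i < k → es′ i ≡ es P i
      es′-old i<k = override-elsewhere e (es P) (ℕ.<⇒≢ i<k)
      joins′ : ∀ i → i < suc k → Joins (lookup (E T) (es′ i)) (vs′ i) (vs′ (suc i))
      joins′ i (s≤s i≤k) with ℕ.m≤n⇒m<n∨m≡n i≤k
      ... | inj₁ i<k rewrite es′-old i<k | vs′-old i≤k | vs′-old i<k = joins P i i<k
      ... | inj₂ refl rewrite override-at i e (es P) | vs′-old i≤k | override-at (suc i) x (vs P) | ends P = e-joins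
      new≢old : ∀ {a b} → a ≡ suc k → b ≤ k → vs′ a ≢ vs′ b
      new≢old {b = b} refl b≤k eq = x∉P b b≤k (trans (sym (vs′-old b≤k)) (trans (sym eq) (override-at (suc k) x (vs P))))
      old-or-new : ∀ {i} → i ≤ suc k → i ≡ suc k ⊎ i ≤ k
      old-or-new {i} i≤1+k with i ≟ suc k
      ... | yes i≡1+k = inj₁ i≡1+k
      ... | no i≢1+k = inj₂ (ℕ.≤-pred (ℕ.≤∧≢⇒< i≤1+k i≢1+k))
      vs′-inj : ∀ a b → a ≤ suc k → b ≤ suc k → vs′ a ≡ vs′ b → a ≡ b
      vs′-inj a b a≤ b≤ eq with old-or-new a≤ | old-or-new b≤
      ... | inj₁ a≡ | inj₁ b≡ = trans a≡ (sym b≡)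
      ... | inj₁ a≡ | inj₂ b≤k = contradiction eq (new≢old a≡ b≤k)
      ... | inj₂ a≤k | inj₁ b≡ = contradiction (sym eq) (new≢old b≡ a≤k)
      ... | inj₂ a≤k | inj₂ b≤k = vs-inj P a b a≤k b≤k (trans (sym (vs′-old a≤k)) (trans eq (vs′-old b≤k)))
      avoids′ : ∀ i → i < suc k → es′ i ≢ f
      avoids′ i (s≤s i≤k) with ℕ.m≤n⇒m<n∨m≡n i≤k
      ... | inj₁ i<k rewrite es′-old i<k = avoids P i i<k
      ... | inj₂ refl rewrite override-at i e (es P) = e≢f

  extend-path : ∀ {p w x} → SimplePathAvoiding p w → (e : EdgeIx T) → Joins (lookup (E T) e) w x → e ≢ f →
                SimplePathAvoiding p x
  extend-path {x = x} P e e-joins e≢f with any? (λ (i : Fin (suc (len P))) → vs P (toℕ i) ≟ᶠ x)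
  ... | yes (i , vsᵢ≡x) = truncate-path P (toℕ i) (toℕ≤pred[n] i) vsᵢ≡x
  ... | no x∉P = append-edge P e e-joins e≢f λ i i≤len eq →
    x∉P (fromℕ< (s≤s i≤len) , trans (cong (vs P) (toℕ-fromℕ< (s≤s i≤len))) eq)

  extend-by-walk : ∀ {F p u x} →
                   (∀ {w y} (e : EdgeIx T) → Joins (lookup (E T) e) w y → w ∉ F → y ∉ F → e ≢ f) →
                   SimplePathAvoiding p u → Reach T F u x → SimplePathAvoiding p x
  extend-by-walk f-not-in-walk P (here _) = P
  extend-by-walk f-not-in-walk P (step r e j y∉F) =
    extend-path (extend-by-walk f-not-in-walk P r) e j (f-not-in-walk e j (reach-target∉ r) y∉F)

  close-path : ∀ {p q} → SimplePathAvoiding p q → Joins (lookup (E T) f) q p → Cycle T ∅ ∅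
  close-path {p} {q} P f-closes = record
    { k = k ; vs = λ i → vs P (toℕ i) ; es = λ i → es′ (toℕ i)
    ; vinj = λ {i} {j} eq → toℕ-injective (vs-inj P (toℕ i) (toℕ j) (toℕ≤pred[n] i) (toℕ≤pred[n] j) eq)
    ; einj = λ {i} {j} eq → toℕ-injective (es′-inj (toℕ i) (toℕ j) (toℕ≤pred[n] i) (toℕ≤pred[n] j) eq)
    ; path = path ; close = close ; vavoid = λ _ → ∉⊥ ; eavoid = λ _ → ∉⊥ }
    where
      k = len P
      es′ = override k f (es P)
      es′-old : ∀ {a} → a < k → es′ a ≡ es P a
      es′-old a<k = override-elsewhere f (es P) (ℕ.<⇒≢ a<k)
      path : ∀ (i : Fin k) → Joins (lookup (E T) (es′ (toℕ (inject₁ i)))) (vs P (toℕ (inject₁ i))) (vs P (toℕ (suc i)))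
      path i rewrite toℕ-inject₁ i | es′-old (toℕ<n i) = joins P (toℕ i) (toℕ<n i)
      close : Joins (lookup (E T) (es′ (toℕ (fromℕ k)))) (vs P (toℕ (fromℕ k))) (vs P 0)
      close rewrite toℕ-fromℕ k | override-at k f (es P) | ends P | starts P = f-closes
      consecutive : ∀ {a b : ℕ} → a ≡ suc b → suc a ≡ b → ⊥
      consecutive {b = b} refl eq = ℕ.<-irrefl (sym eq) (ℕ.m<n⇒m<1+n (ℕ.n<1+n b))
      old-es-inj : ∀ {a b} → a < k → b < k → es P a ≡ es P b → a ≡ b
      old-es-inj {a} {b} a<k b<k eq with joins-unique (joins P a a<k) (subst (λ e → Joins (lookup (E T) e) _ _) (sym eq) (joins P b b<k))
      ... | inj₁ (vsa≡vsb , _) = vs-inj P a b (ℕ.<⇒≤ a<k) (ℕ.<⇒≤ b<k) vsa≡vsb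
      ... | inj₂ (vsa≡vs1+b , vs1+a≡vsb) =
        contradiction (vs-inj P (suc a) b a<k (ℕ.<⇒≤ b<k) vs1+a≡vsb)
                      (consecutive (vs-inj P a (suc b) (ℕ.<⇒≤ a<k) b<k vsa≡vs1+b))
      es′-inj : ∀ a b → a ≤ k → b ≤ k → es′ a ≡ es′ b → a ≡ b
      es′-inj a b a≤k b≤k eq with ℕ.m≤n⇒m<n∨m≡n a≤k | ℕ.m≤n⇒m<n∨m≡n b≤k
      ... | inj₂ a≡k | inj₂ b≡k = trans a≡k (sym b≡k)
      ... | inj₁ a<k | inj₂ refl = contradiction (trans (sym (es′-old a<k)) (trans eq (override-at k f (es P)))) (avoids P a a<k)
      ... | inj₂ refl | inj₁ b<k = contradiction (trans (sym (es′-old b<k)) (trans (sym eq) (override-at k f (es P)))) (avoids P b b<k)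
      ... | inj₁ a<k | inj₁ b<k = old-es-inj a<k b<k (trans (sym (es′-old a<k)) (trans eq (es′-old b<k)))

-- the walk p ⇝ b ⇝ q does not use f, so closing its loop erasure with f gives a cycle
tree-edge-separates : ∀ {T : MG} → ¬ Cycle T ∅ ∅ → (f : EdgeIx T) → ∀ {p q b} → Joins (lookup (E T) f) p q →
                      Reach T ⁅ q ⁆ p b → Reach T ⁅ p ⁆ q b → ⊥
tree-edge-separates {T} acyclic f {p} {q} {b} f-joins p⇝b q⇝b = acyclic (close-path f p-to-q (joins-sym f-joins))
  where
    avoids-end : ∀ z → z ≡ q ⊎ z ≡ p →
                 ∀ {w y} (e : EdgeIx T) → Joins (lookup (E T) e) w y → w ∉ ⁅ z ⁆ → y ∉ ⁅ z ⁆ → e ≢ f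
    avoids-end z z-end e e-joins w∉ y∉ refl with joins-unique e-joins f-joins | z-end
    ... | inj₁ (_ , refl) | inj₁ refl = y∉ (x∈⁅x⁆ _)
    ... | inj₁ (refl , _) | inj₂ refl = w∉ (x∈⁅x⁆ _)
    ... | inj₂ (refl , _) | inj₁ refl = w∉ (x∈⁅x⁆ _)
    ... | inj₂ (_ , refl) | inj₂ refl = y∉ (x∈⁅x⁆ _)
    p-to-b : SimplePathAvoiding f p b
    p-to-b = extend-by-walk f (avoids-end q (inj₁ refl)) (empty-path f p) p⇝b
    p-to-q : SimplePathAvoiding f p q
    p-to-q = extend-by-walk f (avoids-end p (inj₂ refl)) p-to-b (reach-sym q⇝b)

module _ {T : MG} (acyclic : ¬ Cycle T ∅ ∅) (s : ℕ → Fin (n T))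
         (adjacent : ∀ k → Adjacent T (s k) (s (suc k)))
         (moves : ∀ k → s (suc k) ≢ s k) (no-backtrack : ∀ k → s (suc (suc k)) ≢ s k) where

  private
    behind : ∀ m l → l ≤ m → Reach T ⁅ s (suc m) ⁆ (s m) (s l)
    behind zero zero z≤n = here (∉⁅⁆ (moves 0 ∘ sym))
    behind (suc m) l l≤1+m with ℕ.m≤n⇒m<n∨m≡n l≤1+m
    ... | inj₂ refl = here (∉⁅⁆ (moves (suc m) ∘ sym))
    ... | inj₁ (s≤s l≤m) with reach-split (s (suc (suc m))) (behind m l l≤m)
    ...   | inj₁ avoiding = reach-prepend (proj₁ (adjacent m)) (joins-sym (proj₂ (adjacent m)))
                                          (∉⁅⁆ (moves (suc m) ∘ sym)) avoiding
    ...   | inj₂ through = ⊥-elim $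
      tree-edge-separates acyclic (proj₁ (adjacent (suc m))) (proj₂ (adjacent (suc m)))
        (step (here (∉⁅⁆ (moves (suc m) ∘ sym))) (proj₁ (adjacent m)) (joins-sym (proj₂ (adjacent m)))
              (∉⁅⁆ (no-backtrack m ∘ sym)))
        (reach-trans through (reach-sym (behind m l l≤m)))

  non-backtracking-walk-injective : ∀ l m → l ≤ m → s l ≢ s (suc m)
  non-backtracking-walk-injective l m l≤m sl≡s1+m =
    reach-target∉ (behind m l l≤m) (subst (_∈ ⁅ s (suc m) ⁆) (sym sl≡s1+m) (x∈⁅x⁆ _))

  no-infinite-non-backtracking-walk : ⊥
  no-infinite-non-backtracking-walk with pigeonhole (ℕ.n<1+n (n T)) (λ (i : Fin (suc (n T))) → s (toℕ i))
  ... | i , j , i<j , eq with toℕ j | i<j | eq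
  ...   | suc j′ | s≤s i≤j′ | eq′ = non-backtracking-walk-injective (toℕ i) j′ i≤j′ eq′

-- Tree decompositions and tree-cut decompositions

module _ {H : MG} (D : TreeDecomp H) where
  open TreeDecomp D

  bags-containing-connected : ∀ {v t a b} → v ∉ B t → v ∈ B a → v ∈ B b → Reach T ⁅ t ⁆ a b
  bags-containing-connected {v} {t} {a} {b} v∉Bt v∈Ba v∈Bb = reach-mono t∉bags (conn v a b v∈Ba v∈Bb)
    where
      t∉bags : ⁅ t ⁆ ⊆ ∁ (Vec.tabulate λ c → Vec.lookup (B c) v)
      t∉bags x∈⁅t⁆ rewrite x∈⁅y⁆⇒x≡y _ x∈⁅t⁆ = x∉p⇒x∈∁p (v∉Bt ∘ lookup⇒[]= v (B t) ∘ ∈-tabulate⁻)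

  -- If every bag missed a vertex, stepping from each node towards the
  -- bags containing a vertex it misses would never backtrack: the tree edge of a step would separate
  -- both of its ends from a bag holding both missing vertices.
  pairwise-shared⇒common-bag : (∀ v w → ∃ λ b → v ∈ B b × w ∈ B b) → ∃ λ t → ∀ v → v ∈ B t
  pairwise-shared⇒common-bag shared with any? (λ t → all? (λ v → v ∈? B t))
  ... | yes full-bag = full-bag
  ... | no no-full-bag = ⊥-elim (no-infinite-non-backtracking-walk acyclic walk adjacent moves no-backtrack)
    where
      acyclic : ¬ Cycle T ∅ ∅
      acyclic = proj₂ (proj₂ tree)
      connected : ∀ a b → Reach T ∅ a b
      connected = proj₁ (proj₂ tree)
      missing : ∀ t → ∃ λ v → v ∉ B t
      missing t = ¬∀⟶∃¬ _ _ (λ v → v ∈? B t) (λ all-in → no-full-bag (t , all-in))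
      exit : ∀ t → ∃ λ u → Adjacent T t u × u ≢ t × Reach T ⁅ t ⁆ u (proj₁ (vcover (proj₁ (missing t))))
      exit t = last-exit t (connected _ _) λ t≡b → proj₂ (missing t) (subst (λ b → _ ∈ B b) (sym t≡b) (proj₂ (vcover _)))
      toward : Fin (n T) → Fin (n T)
      toward t = proj₁ (exit t)
      toward-reaches : ∀ t {b} → proj₁ (missing t) ∈ B b → Reach T ⁅ t ⁆ (toward t) b
      toward-reaches t v∈Bb =
        reach-trans (proj₂ (proj₂ (proj₂ (exit t)))) (bags-containing-connected (proj₂ (missing t)) (proj₂ (vcover _)) v∈Bb)
      walk : ℕ → Fin (n T)
      walk zero = fromℕ< (proj₁ tree)
      walk (suc k) = toward (walk k)
      adjacent : ∀ k → Adjacent T (walk k) (walk (suc k))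
      adjacent k = proj₁ (proj₂ (exit (walk k)))
      moves : ∀ k → walk (suc k) ≢ walk k
      moves k = proj₁ (proj₂ (proj₂ (exit (walk k))))
      no-backtrack : ∀ k → walk (suc (suc k)) ≢ walk k
      no-backtrack k back with shared (proj₁ (missing (walk k))) (proj₁ (missing (walk (suc k))))
      ... | b , v∈Bb , v′∈Bb =
        tree-edge-separates acyclic (proj₁ (adjacent k)) (proj₂ (adjacent k))
          (subst (λ t → Reach T ⁅ walk (suc k) ⁆ t b) back (toward-reaches (walk (suc k)) v′∈Bb))
          (toward-reaches (walk k) v∈Bb)

module _ {N thr : ℕ} {P : Subset N} where

  suppression-removes : ∀ {s s′} → Supp thr P s s′ → ∃ λ v → v ∉ P × St.alive s′ ≡ St.alive s - v
  suppression-removes (deg0 _ v∉P _) = _ , v∉P , refl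
  suppression-removes (deg1 _ _ v∉P _ _ _ _) = _ , v∉P , refl
  suppression-removes (deg2loop _ _ v∉P _ _) = _ , v∉P , refl
  suppression-removes (deg2 _ _ v∉P _ _ _ _ _ _) = _ , v∉P , refl

  suppression-keeps-protected : ∀ {s s′} → Supp thr P s s′ → ∀ {x} → x ∈ P → x ∈ St.alive s → x ∈ St.alive s′
  suppression-keeps-protected supp x∈P x-alive with suppression-removes supp
  ... | v , v∉P , refl = x∈p∧x∉q⇒x∈p─q x-alive (λ x∈⁅v⁆ → v∉P (subst (_∈ P) (x∈⁅y⁆⇒x≡y v x∈⁅v⁆) x∈P))

  suppressions-keep-protected : ∀ {s s′} → Star (Supp thr P) s s′ → ∀ {x} → x ∈ P → x ∈ St.alive s → x ∈ St.alive s′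
  suppressions-keep-protected ε _ x-alive = x-alive
  suppressions-keep-protected (supp ◅ supps) x∈P x-alive =
    suppressions-keep-protected supps x∈P (suppression-keeps-protected supp x∈P x-alive)

  suppress-isolated : ∀ (xs : List (Fin N)) al →
                      ∃ λ al′ → Star (Supp thr P) (st al []) (st al′ []) × (∀ {x} → x ∈ₗ xs → x ∈ al′ → x ∈ P)
  suppress-isolated [] al = al , ε , λ ()
  suppress-isolated (y ∷ ys) al with suppress-isolated ys al
  ... | al′ , supps , ys-protected with y ∈? al′ | y ∈? P
  ...   | _ | yes y∈P = al′ , supps , λ { (here refl) _ → y∈P ; (there x∈ys) → ys-protected x∈ys }
  ...   | no y∉al′ | no _ = al′ , supps , λ
    { (here refl) y∈al′ → contradiction y∈al′ y∉al′
    ; (there x∈ys) → ys-protected x∈ys }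
  ...   | yes y∈al′ | no y∉P = al′ - y , supps ◅◅ (deg0 y∈al′ y∉P [] ◅ ε) , λ
    { (here refl) y∈al′-y → contradiction (x∈⁅x⁆ y) (x∈p─q⇒x∉q y∈al′-y)
    ; (there x∈ys) x∈al′-y → ys-protected x∈ys (p─q⊆p al′ ⁅ y ⁆ x∈al′-y) }

  CenterLE-from-edgeless : ∀ {s al k} → Star (Supp thr P) s (st al []) → ∣ P ∣ ≤ k → CenterLE thr P s k
  CenterLE-from-edgeless {al = al} supps P≤k with suppress-isolated (allFin N) al
  ... | al′ , more-supps , protected =
    st al′ [] , supps ◅◅ more-supps ,
    (λ v v∈al′ v∉P → contradiction (protected (∈-allFin v) v∈al′) v∉P) ,
    ℕ.≤-trans (p⊆q⇒∣p∣≤∣q∣ (protected (∈-allFin _))) P≤k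

module _ {H : MG} (D : TreeCutDecomp H) where
  open TreeCutDecomp D

  bag-vertex-in-torso : ∀ {t v} → v ∈ X t → v ↑ˡ n T ∈ torsoAlive D t × v ↑ˡ n T ∈ torsoProt D t
  bag-vertex-in-torso {t} {v} v∈Xt = ∈-tabulate⁺ in-bag , ∈-tabulate⁺ in-bag
    where
      in-bag : ∀ {g} → [ Vec.lookup (X t) , g ] (splitAt (n H) (v ↑ˡ n T)) ≡ true
      in-bag rewrite splitAt-↑ˡ (n H) v (n T) = []=⇒lookup v∈Xt

  full-bag⇒torso-large : ∀ {thr t k} → (∀ v → v ∈ X t) → TorLE D thr t k → n H ≤ k
  full-bag⇒torso-large all-in (_ , _ , s′ , supps , _ , center≤k) =
    ℕ.≤-trans (injective-into⇒≤∣p∣ (_↑ˡ n T) (↑ˡ-injective (n T) _ _) survives) center≤k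
    where
      survives : ∀ v → v ↑ˡ n T ∈ St.alive s′
      survives v = suppressions-keep-protected supps (proj₂ (bag-vertex-in-torso (all-in v)))
                                                     (proj₁ (bag-vertex-in-torso (all-in v)))

  crosses : ∀ {p q a c b₁ b₂} (f : EdgeIx T) → Joins (lookup (E T) f) p q → a ∈ X b₁ → c ∈ X b₂ →
            Reach T ⁅ q ⁆ p b₁ → Reach T ⁅ p ⁆ q b₂ →
            ∀ {z : Fin (n H) × Fin (n H)} → Joins z a c → Crosses D (proj₁ (lookup (E T) f)) (proj₂ (lookup (E T) f)) z
  crosses f (inj₁ (refl , refl)) a∈ c∈ p⇝b₁ q⇝b₂ (inj₁ (refl , refl)) = _ , _ , a∈ , c∈ , inj₁ (p⇝b₁ , q⇝b₂)
  crosses f (inj₁ (refl , refl)) a∈ c∈ p⇝b₁ q⇝b₂ (inj₂ (refl , refl)) = _ , _ , c∈ , a∈ , inj₂ (p⇝b₁ , q⇝b₂)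
  crosses f (inj₂ (refl , refl)) a∈ c∈ p⇝b₁ q⇝b₂ (inj₁ (refl , refl)) = _ , _ , a∈ , c∈ , inj₂ (q⇝b₂ , p⇝b₁)
  crosses f (inj₂ (refl , refl)) a∈ c∈ p⇝b₁ q⇝b₂ (inj₂ (refl , refl)) = _ , _ , c∈ , a∈ , inj₁ (q⇝b₂ , p⇝b₁)

  torsoProt⁻ : ∀ {t x} → x ∈ torsoProt D t → ∃ λ v → v ∈ X t × v ↑ˡ n T ≡ x
  torsoProt⁻ {t} {x} x∈ with splitAt (n H) x in eq | ∈-tabulate⁻ {x = x} x∈
  ... | inj₁ v | v∈Xt = v , lookup⇒[]= v (X t) v∈Xt , splitAt⁻¹-↑ˡ eq

  consolidated∉torsoProt : ∀ {t} u → n H ↑ʳ u ∉ torsoProt D t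
  consolidated∉torsoProt {t} u u∈ with splitAt (n H) (n H ↑ʳ u) | splitAt-↑ʳ (n H) (n T) u | ∈-tabulate⁻ u∈
  ... | _ | refl | ()

  adjB-complete : ∀ {t u} → AdjT D t u → adjB D t u ≡ true
  adjB-complete {t} {u} (f , f-joins) =
    Equivalence.to T-≡ (any⁺ _ (Any.map (λ { refl → adjacency-test f-joins }) (∈-lookup {xs = E T} f)))
    where
      adjacency-test : ∀ {e : Fin (n T) × Fin (n T)} → Joins e t u →
                       IsTrue ((⌊ proj₁ e ≟ᶠ t ⌋ ∧ ⌊ proj₂ e ≟ᶠ u ⌋) ∨ (⌊ proj₁ e ≟ᶠ u ⌋ ∧ ⌊ proj₂ e ≟ᶠ t ⌋))
      adjacency-test (inj₁ (refl , refl)) rewrite ⌊x≟x⌋ t | ⌊x≟x⌋ u = _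
      adjacency-test (inj₂ (refl , refl)) rewrite ⌊x≟x⌋ t | ⌊x≟x⌋ u | ∨-zeroʳ (⌊ u ≟ᶠ t ⌋ ∧ ⌊ t ≟ᶠ u ⌋) = _

  neighbour∈torsoAlive : ∀ {t u} → AdjT D t u → n H ↑ʳ u ∈ torsoAlive D t
  neighbour∈torsoAlive {t} {u} t-u =
    ∈-tabulate⁺ (trans (cong [ Vec.lookup (X t) , adjB D t ] (splitAt-↑ʳ (n H) (n T) u)) (adjB-complete t-u))

-- The complete graph

edgeless-instance : ℕ → Instance
edgeless-instance m = record
  { G = record { n = m ; E = [] ; loopless = [] ; noParallel = λ () }
  ; 𝒯 = ⊤ ∷ [] ; 𝒯-set = [] ∷ [] ; d = λ _ → 1 ; d-pos = λ _ → s≤s z≤n }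

complete : ℕ → MG
complete m = cliqueAug (edgeless-instance m)

module _ {m : ℕ} where

  ∈-complete : ∀ (u v : Fin m) → toℕ u < toℕ v → (u , v) ∈ₗ E (complete m)
  ∈-complete u v u<v = ∈-concatMap⁺ cliqueOn {xs = ⊤ ∷ []} (here ∈-clique)
    where
      ∈-pair : (u , v) ∈ₗ (if Vec.lookup ⊤ u ∧ Vec.lookup ⊤ v ∧ ⌊ toℕ u <? toℕ v ⌋ then (u , v) ∷ [] else [])
      ∈-pair rewrite lookup-replicate u true | lookup-replicate v true with toℕ u <? toℕ v
      ... | yes _ = here refl
      ... | no u≮v = contradiction u<v u≮v
      ∈-clique : (u , v) ∈ₗ cliqueOn ⊤
      ∈-clique = ∈-concatMap⁺ _ (Any.map (λ { refl → ∈-concatMap⁺ _ (Any.map (λ { refl → ∈-pair }) (∈-allFin v)) })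
                                        (∈-allFin u))

  complete-edge : ∀ (u v : Fin m) → u ≢ v → Adjacent (complete m) u v
  complete-edge u v u≢v with <-cmp u v
  ... | tri< u<v _ _ = Any.index (∈-complete u v u<v) , inj₁ (cong proj₁ (sym eq) , cong proj₂ (sym eq))
    where eq = lookup-index (∈-complete u v u<v)
  ... | tri≈ _ u≡v _ = contradiction u≡v u≢v
  ... | tri> _ _ v<u = Any.index (∈-complete v u v<u) , inj₂ (cong proj₁ (sym eq) , cong proj₂ (sym eq))
    where eq = lookup-index (∈-complete v u v<u)

  complete-reach : ∀ {F u v} → u ∉ F → v ∉ F → Reach (complete m) F u v
  complete-reach {u = u} {v} u∉F v∉F with u ≟ᶠ v
  ... | yes refl = here u∉F
  ... | no u≢v = step (here u∉F) (proj₁ (complete-edge u v u≢v)) (proj₂ (complete-edge u v u≢v)) v∉F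

  module _ (h : Fin 3 → Fin m) (h-inj : Injective _≡_ _≡_ h) where

    private
      next : Fin 3 → Fin 3
      next zero = suc zero
      next (suc zero) = suc (suc zero)
      next (suc (suc zero)) = zero

      next≢id : ∀ i → next i ≢ i
      next≢id zero ()
      next≢id (suc zero) ()
      next≢id (suc (suc zero)) ()

      next²≢id : ∀ i → next (next i) ≢ i
      next²≢id zero ()
      next²≢id (suc zero) ()
      next²≢id (suc (suc zero)) ()

      side : ∀ i → Adjacent (complete m) (h i) (h (next i))
      side i = complete-edge (h i) (h (next i)) (next≢id i ∘ sym ∘ h-inj)

      side-inj : Injective _≡_ _≡_ (proj₁ ∘ side)
      side-inj {i} {j} eq
        with joins-unique (proj₂ (side i))
                          (subst (λ e → Joins (lookup (E (complete m)) e) (h j) (h (next j))) (sym eq) (proj₂ (side j)))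
      ... | inj₁ (hi≡hj , _) = h-inj hi≡hj
      ... | inj₂ (hi≡hnj , hni≡hj) = contradiction (trans (sym (cong next (h-inj hi≡hnj))) (h-inj hni≡hj)) (next²≢id j)

    triangle : ∀ {F D} → (∀ i → h i ∉ F) →
               (∀ {e i j} → Joins (lookup (E (complete m)) e) (h i) (h j) → e ∉ D) → Cycle (complete m) F D
    triangle h∉F avoids-D = record
      { k = 2 ; vs = h ; es = proj₁ ∘ side ; vinj = h-inj ; einj = side-inj
      ; path = λ { zero → proj₂ (side zero) ; (suc zero) → proj₂ (side (suc zero)) }
      ; close = proj₂ (side (suc (suc zero)))
      ; vavoid = h∉F ; eavoid = λ i → avoids-D (proj₂ (side i)) }

¬VC≤-complete : ∀ c → ¬ VC≤ (complete (2 + c)) c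
¬VC≤-complete c (S , S≤c , covers)
  with untagged-injection id S S≤c 2 id id
... | h , h-inj , untagged with complete-edge (h zero) (h (suc zero)) (λ eq → contradiction (h-inj eq) λ ())
...   | e , e-joins with covers e
...     | inj₁ ∈S = untagged-either⇒∉ (untagged zero) (untagged (suc zero)) (joins-proj₁ e-joins) ∈S
...     | inj₂ ∈S = untagged-either⇒∉ (untagged zero) (untagged (suc zero)) (joins-proj₂ e-joins) ∈S

¬FVS≤-complete : ∀ c → ¬ FVS≤ (complete (3 + c)) c
¬FVS≤-complete c (S , S≤c , acyclic)
  with untagged-injection id S S≤c 3 id id
... | h , h-inj , untagged = acyclic (triangle h h-inj (λ i → untagged⇒∉ (untagged i) refl) (λ _ → ∉⊥))

-- charging each edge of D to its first endpoint, a triangle on three uncharged vertices avoids D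
¬FEN≤-complete : ∀ c → ¬ FEN≤ (complete (3 + c)) c
¬FEN≤-complete c (D , D≤c , acyclic)
  with untagged-injection (proj₁ ∘ lookup (E (complete (3 + c)))) D D≤c 3 id id
... | h , h-inj , untagged = acyclic (triangle h h-inj (λ _ → ∉⊥)
        (λ {_} {i} {j} e-joins → untagged-either⇒∉ (untagged i) (untagged j) (joins-proj₁ e-joins)))

¬FN≤-complete : ∀ c → ¬ FN≤ (complete (suc c + suc c)) c
¬FN≤-complete c (S , S≤c , small-components) =
  contradiction (ℕ.≤-trans m≤∣S∣+∣∁S∣ (ℕ.+-mono-≤ S≤c (ℕ.≤-trans ∣∁S∣≤∣S∣ S≤c)))
                (ℕ.<⇒≱ (ℕ.+-mono-< (ℕ.n<1+n c) (ℕ.n<1+n c)))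
  where
    m = suc c + suc c
    m≤∣S∣+∣∁S∣ : m ≤ ∣ S ∣ + ∣ ∁ S ∣
    m≤∣S∣+∣∁S∣ = subst (λ k → m ≤ ∣ S ∣ + k) (sym (∣∁p∣≡n∸∣p∣ S)) (ℕ.m≤n+m∸n m ∣ S ∣)
    ∣∁S∣≤∣S∣ : ∣ ∁ S ∣ ≤ ∣ S ∣
    ∣∁S∣≤∣S∣ with any? (λ v → ¬? (v ∈? S))
    ... | yes (v , v∉S) = small-components v v∉S (∁ S) (λ w w∈∁S → complete-reach v∉S (x∈∁p⇒x∉p w∈∁S))
    ... | no none = ℕ.≤-trans (p⊆q⇒∣p∣≤∣q∣ {q = ∅} (λ {w} w∈∁S → contradiction (w , x∈∁p⇒x∉p w∈∁S) none))
                              (ℕ.≤-trans (ℕ.≤-reflexive (∣⊥∣≡0 m)) z≤n)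

¬TW≤-complete : ∀ c → ¬ TW≤ (complete (2 + c)) c
¬TW≤-complete c (D , bags≤) with pairwise-shared⇒common-bag D shared
  where
    open TreeDecomp D
    shared : ∀ v w → ∃ λ b → v ∈ B b × w ∈ B b
    shared v w with v ≟ᶠ w
    ... | yes refl = proj₁ (vcover v) , proj₂ (vcover v) , proj₂ (vcover v)
    ... | no v≢w with complete-edge v w v≢w
    ...   | e , e-joins with ecover e | e-joins
    ...     | b , ∈B , ∈B′ | inj₁ (refl , refl) = b , ∈B , ∈B′
    ...     | b , ∈B , ∈B′ | inj₂ (refl , refl) = b , ∈B′ , ∈B
... | t , all-in = ℕ.1+n≰n (ℕ.≤-trans (injective-into⇒≤∣p∣ id id all-in) (bags≤ t))

module _ {c : ℕ} (D : TreeCutDecomp (complete (2 + c))) where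
  open TreeCutDecomp D
  private
    H = complete (2 + c)

  -- with a on p's side of the tree edge f and z on q's side, each of the c + 1 vertices other than a
  -- has an edge crossing f, to z or to a according to the side of its own bag
  module _ (f : EdgeIx T) {p q} (f-joins : Joins (lookup (E T) f) p q) (p≢q : p ≢ q)
           {a z bₐ b_z} (a∈bₐ : a ∈ X bₐ) (p⇝bₐ : Reach T ⁅ q ⁆ p bₐ)
           (z∈b_z : z ∈ X b_z) (q⇝b_z : Reach T ⁅ p ⁆ q b_z) where

    private
      Crossing : EdgeIx H → Set
      Crossing e = Crosses D (proj₁ (lookup (E T) f)) (proj₂ (lookup (E T) f)) (lookup (E H) e)

      crossing-to-a-or-z : ∀ v → v ≢ a → ∃ λ e → ∃ λ y → Joins (lookup (E H) e) v y × (y ≡ a ⊎ y ≡ z) × Crossing e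
      crossing-to-a-or-z v v≢a with v ≟ᶠ z
      ... | yes refl = proj₁ e , a , proj₂ e , inj₁ refl , crosses D f f-joins a∈bₐ z∈b_z p⇝bₐ q⇝b_z (joins-sym (proj₂ e))
        where e = complete-edge v a v≢a
      ... | no v≢z with reach-side p≢q (proj₁ (proj₂ tree) p (proj₁ (part v)))
      ...   | inj₁ p⇝bᵥ = proj₁ e , z , proj₂ e , inj₂ refl ,
                          crosses D f f-joins (proj₂ (part v)) z∈b_z p⇝bᵥ q⇝b_z (proj₂ e)
        where e = complete-edge v z v≢z
      ...   | inj₂ q⇝bᵥ = proj₁ e , a , proj₂ e , inj₁ refl ,
                          crosses D f f-joins a∈bₐ (proj₂ (part v)) p⇝bₐ q⇝bᵥ (joins-sym (proj₂ e))
        where e = complete-edge v a v≢a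

      crossing-from : ∀ i → ∃ λ e → ∃ λ y → Joins (lookup (E H) e) (punchIn a i) y × (y ≡ a ⊎ y ≡ z) × Crossing e
      crossing-from i = crossing-to-a-or-z (punchIn a i) (punchInᵢ≢i a i)

      crossing : Fin (suc c) → EdgeIx H
      crossing i = proj₁ (crossing-from i)

      other-end-is-z : ∀ {i} {y} → y ≡ a ⊎ y ≡ z → punchIn a i ≡ y → punchIn a i ≡ z
      other-end-is-z {i} (inj₁ refl) eq = contradiction eq (punchInᵢ≢i a i)
      other-end-is-z (inj₂ refl) eq = eq

      crossing-inj : Injective _≡_ _≡_ crossing
      crossing-inj {i} {j} eq with crossing-from i | crossing-from j | eq
      ... | _ , y , i-joins , y-end , _ | _ , y′ , j-joins , y′-end , _ | refl with joins-unique i-joins j-joins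
      ...   | inj₁ (i≡j , _) = punchIn-injective a i j i≡j
      ...   | inj₂ (i≡y′ , y≡j) =
        punchIn-injective a i j (trans (other-end-is-z y′-end i≡y′) (sym (other-end-is-z y-end (sym y≡j))))

      image-crosses : ∀ e → e ∈ image crossing → Crossing e
      image-crosses e e∈ with ∈-image⁻ crossing e∈
      ... | i , refl = proj₂ (proj₂ (proj₂ (proj₂ (crossing-from i))))

    large-adhesion : ¬ AdhLE D f c
    large-adhesion adhesion =
      ℕ.1+n≰n (ℕ.≤-trans (injective-into⇒≤∣p∣ crossing crossing-inj (∈-image⁺ crossing))
                         (adhesion (image crossing) image-crosses))

  small-adhesion⇒full-bag : (∀ f → AdhLE D f c) → ∀ a w → w ∈ X (proj₁ (part a))
  small-adhesion⇒full-bag adhesion a w with w ∈? X (proj₁ (part a))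
  ... | yes w∈ = w∈
  ... | no w∉
    with last-exit tₐ (proj₁ (proj₂ tree) tₐ t_w) (λ tₐ≡t_w → w∉ (subst (λ t → w ∈ X t) (sym tₐ≡t_w) (proj₂ (part w))))
    where
      tₐ = proj₁ (part a)
      t_w = proj₁ (part w)
  ...   | u , (f , f-joins) , u≢tₐ , u⇝t_w =
    ⊥-elim (large-adhesion f f-joins (u≢tₐ ∘ sym) (proj₂ (part a)) (here (∉⁅⁆ (u≢tₐ ∘ sym)))
                           (proj₂ (part w)) u⇝t_w (adhesion f))

¬TCWthr≤-complete : ∀ thr c → ¬ TCWthr≤ thr (complete (2 + c)) c
¬TCWthr≤-complete thr c (D , adhesion , torsos) =
  ℕ.1+n≰n (ℕ.m+n≤o⇒n≤o 1 (full-bag⇒torso-large D (small-adhesion⇒full-bag D adhesion zero) (torsos _)))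

-- The star

↑ˡ≢↑ʳ : ∀ {m n} (i : Fin m) (j : Fin n) → i ↑ˡ n ≢ m ↑ʳ j
↑ˡ≢↑ʳ {m} {n} i j eq with trans (sym (splitAt-↑ˡ m i n)) (trans (cong (splitAt m) eq) (splitAt-↑ʳ m n j))
... | ()

centre : ∀ m → Fin (m + 1)
centre m = m ↑ʳ zero

leaf : ∀ {m} → Fin m → Fin (m + 1)
leaf ℓ = ℓ ↑ˡ 1

spoke : ∀ {m} → Fin m → Fin (m + 1) × Fin (m + 1)
spoke {m} ℓ = leaf ℓ , centre m

star : ℕ → MG
star m = mg (m + 1) (map spoke (allFin m))

vertAug-edgeless≡star : ∀ m → vertAug (edgeless-instance m) ≡ star m
vertAug-edgeless≡star m = cong (mg (m + 1)) (trans (++-identityʳ _) (spokes (allFin m)))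
  where
    spokes : ∀ xs → concatMap (λ u → if Vec.lookup ⊤ u then (u ↑ˡ 1 , m ↑ʳ zero) ∷ [] else []) xs ≡ map spoke xs
    spokes [] = refl
    spokes (x ∷ xs) rewrite lookup-replicate x true = cong (spoke x ∷_) (spokes xs)

module _ {m : ℕ} where
  private
    S = star m
    c = centre m
    M = m + 1

  leaf≢centre : ∀ ℓ → leaf ℓ ≢ c
  leaf≢centre ℓ = ↑ˡ≢↑ʳ ℓ zero

  leaf-or-centre : ∀ x → x ≡ c ⊎ ∃ λ ℓ → x ≡ leaf ℓ
  leaf-or-centre x with splitAt m x in eq
  ... | inj₁ ℓ = inj₂ (ℓ , sym (splitAt⁻¹-↑ˡ eq))
  ... | inj₂ zero = inj₁ (sym (splitAt⁻¹-↑ʳ eq))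

  star-edge-is-spoke : ∀ e → ∃ λ ℓ → lookup (E S) e ≡ spoke ℓ
  star-edge-is-spoke e with ∈-map⁻ spoke (∈-lookup {xs = E S} e)
  ... | ℓ , _ , eq = ℓ , eq

  spoke-edge : ∀ ℓ → Adjacent S (leaf ℓ) c
  spoke-edge ℓ = Any.index ∈E , inj₁ (cong proj₁ eq , cong proj₂ eq)
    where
      ∈E = ∈-map⁺ spoke (∈-allFin ℓ)
      eq = sym (lookup-index ∈E)

  star-lookup-injective : ∀ e e′ → lookup (E S) e ≡ lookup (E S) e′ → e ≡ e′
  star-lookup-injective = lookup-injective (map⁺ (↑ˡ-injective 1 _ _ ∘ cong proj₁) (allFin⁺ m))

  star-joins : ∀ {e x y} → Joins (lookup (E S) e) x y →
               ∃ λ ℓ → lookup (E S) e ≡ spoke ℓ × ((x ≡ leaf ℓ × y ≡ c) ⊎ (x ≡ c × y ≡ leaf ℓ))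
  star-joins {e} e-joins with star-edge-is-spoke e
  ... | ℓ , eq with lookup (E S) e | e-joins
  ...   | _ | inj₁ (refl , refl) = ℓ , eq , inj₁ (cong proj₁ eq , cong proj₂ eq)
  ...   | _ | inj₂ (refl , refl) = ℓ , eq , inj₂ (cong proj₂ eq , cong proj₁ eq)

  joins-centre : ∀ {e x y} → Joins (lookup (E S) e) x y → x ≡ c ⊎ y ≡ c
  joins-centre e-joins with star-joins e-joins
  ... | _ , _ , inj₁ (_ , y≡c) = inj₂ y≡c
  ... | _ , _ , inj₂ (x≡c , _) = inj₁ x≡c

  same-ends⇒same-edge : ∀ {e e′ x y} → Joins (lookup (E S) e) x y → Joins (lookup (E S) e′) x y → e ≡ e′
  same-ends⇒same-edge {e} {e′} e-joins e′-joins with star-joins e-joins | star-joins e′-joins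
  ... | ℓ , eq , inj₁ (x≡ℓ , _) | ℓ′ , eq′ , inj₁ (x≡ℓ′ , _) =
    star-lookup-injective e e′ (trans eq (trans (cong spoke (↑ˡ-injective 1 _ _ (trans (sym x≡ℓ) x≡ℓ′))) (sym eq′)))
  ... | ℓ , _ , inj₁ (x≡ℓ , _) | _ , _ , inj₂ (x≡c , _) = contradiction (trans (sym x≡ℓ) x≡c) (leaf≢centre ℓ)
  ... | _ , _ , inj₂ (x≡c , _) | ℓ′ , _ , inj₁ (x≡ℓ′ , _) = contradiction (trans (sym x≡ℓ′) x≡c) (leaf≢centre ℓ′)
  ... | ℓ , eq , inj₂ (_ , y≡ℓ) | ℓ′ , eq′ , inj₂ (_ , y≡ℓ′) =
    star-lookup-injective e e′ (trans eq (trans (cong spoke (↑ˡ-injective 1 _ _ (trans (sym y≡ℓ) y≡ℓ′))) (sym eq′)))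

  private
    no-cycle : ∀ k (vs : Fin (suc k) → Fin (m + 1)) (es : Fin (suc k) → EdgeIx S) →
               Injective _≡_ _≡_ vs → Injective _≡_ _≡_ es →
               (∀ (i : Fin k) → Joins (lookup (E S) (es (inject₁ i))) (vs (inject₁ i)) (vs (suc i))) →
               Joins (lookup (E S) (es (fromℕ k))) (vs (fromℕ k)) (vs zero) → ⊥
    no-cycle zero vs es _ _ _ loop with star-joins loop
    ... | ℓ , _ , inj₁ (x≡ℓ , x≡c) = leaf≢centre ℓ (trans (sym x≡ℓ) x≡c)
    ... | ℓ , _ , inj₂ (x≡c , x≡ℓ) = leaf≢centre ℓ (trans (sym x≡ℓ) x≡c)
    no-cycle (suc zero) vs es _ es-inj path close
      with es-inj (same-ends⇒same-edge (path zero) (joins-sym close))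
    ... | ()
    -- among v₀ v₁ v₂ only v₁ can be the centre, and then the edge leaving v₂ misses it
    no-cycle (suc (suc k)) vs es vs-inj _ path close
      with joins-centre (path zero) | joins-centre (path (suc zero)) | edge-from-v₂ k vs es path close
      where
        edge-from-v₂ : ∀ k (vs : Fin (3 + k) → Fin (m + 1)) (es : Fin (3 + k) → EdgeIx S) →
                       (∀ (i : Fin (2 + k)) → Joins (lookup (E S) (es (inject₁ i))) (vs (inject₁ i)) (vs (suc i))) →
                       Joins (lookup (E S) (es (fromℕ (2 + k)))) (vs (fromℕ (2 + k))) (vs zero) →
                       ∃ λ j → j ≢ suc zero × (vs (suc (suc zero)) ≡ c ⊎ vs j ≡ c)
        edge-from-v₂ zero vs es path close = zero , (λ ()) , joins-centre close
        edge-from-v₂ (suc k) vs es path close = suc (suc (suc zero)) , (λ ()) , joins-centre (path (suc (suc zero)))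
    ... | inj₁ v₀≡c | inj₁ v₁≡c | _ = contradiction (vs-inj (trans v₀≡c (sym v₁≡c))) λ ()
    ... | inj₁ v₀≡c | inj₂ v₂≡c | _ = contradiction (vs-inj (trans v₀≡c (sym v₂≡c))) λ ()
    ... | inj₂ v₁≡c | _ | _ , _ , inj₁ v₂≡c = contradiction (vs-inj (trans v₁≡c (sym v₂≡c))) λ ()
    ... | inj₂ v₁≡c | _ | j , j≢1 , inj₂ vⱼ≡c = j≢1 (vs-inj (trans vⱼ≡c (sym v₁≡c)))

  star-acyclic : ∀ {F D} → ¬ Cycle S F D
  star-acyclic cycle = no-cycle k vs es vinj einj path close
    where open Cycle cycle

  reach-centre : ∀ {F a} → a ∉ F → c ∉ F → Reach S F a c
  reach-centre {a = a} a∉F c∉F with leaf-or-centre a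
  ... | inj₁ refl = here a∉F
  ... | inj₂ (ℓ , refl) = step (here a∉F) (proj₁ (spoke-edge ℓ)) (proj₂ (spoke-edge ℓ)) c∉F

  reach-via-centre : ∀ {F a b} → a ∉ F → b ∉ F → c ∉ F → Reach S F a b
  reach-via-centre a∉F b∉F c∉F = reach-trans (reach-centre a∉F c∉F) (reach-sym (reach-centre b∉F c∉F))

  star-is-tree : IsTree S
  star-is-tree = ℕ.m≤n+m 1 m , (λ _ _ → reach-via-centre ∉⊥ ∉⊥ ∉⊥) , star-acyclic

  reach-avoiding-centre-trivial : ∀ {v w} → Reach S ⁅ c ⁆ v w → w ≡ v
  reach-avoiding-centre-trivial (here _) = refl
  reach-avoiding-centre-trivial (step r _ e-joins x∉⁅c⁆) with joins-centre e-joins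
  ... | inj₁ w≡c = contradiction (subst (_∈ ⁅ c ⁆) (sym w≡c) (x∈⁅x⁆ c)) (reach-target∉ r)
  ... | inj₂ x≡c = contradiction (subst (_∈ ⁅ c ⁆) (sym x≡c) (x∈⁅x⁆ c)) x∉⁅c⁆

  VC≤-star : VC≤ S 1
  VC≤-star = ⁅ c ⁆ , ∣⁅x⁆∣≤1 c , λ e →
    inj₂ (subst (_∈ ⁅ c ⁆) (sym (cong proj₂ (proj₂ (star-edge-is-spoke e)))) (x∈⁅x⁆ c))

  FVS≤-star : FVS≤ S 0
  FVS≤-star = ∅ , ℕ.≤-reflexive (∣⊥∣≡0 (m + 1)) , star-acyclic

  FEN≤-star : FEN≤ S 0
  FEN≤-star = ∅ , ℕ.≤-reflexive (∣⊥∣≡0 (length (E S))) , star-acyclic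

  FN≤-star : FN≤ S 1
  FN≤-star = ⁅ c ⁆ , ∣⁅x⁆∣≤1 c , λ v _ C reachable →
    subst (∣ C ∣ ≤_) (sym (∣⁅x⁆∣≡1 c))
      (ℕ.≤-trans (p⊆q⇒∣p∣≤∣q∣ λ {w} w∈C →
                    subst (_∈ ⁅ v ⁆) (sym (reach-avoiding-centre-trivial (reachable w w∈C))) (x∈⁅x⁆ v))
                 (∣⁅x⁆∣≤1 v))

  TW≤-star : TW≤ S 1
  TW≤-star = decomposition , λ t →
    ℕ.≤-trans (∣p∪q∣≤∣p∣+∣q∣ ⁅ t ⁆ ⁅ c ⁆) (ℕ.+-mono-≤ (∣⁅x⁆∣≤1 t) (∣⁅x⁆∣≤1 c))
    where
      bag : Fin (m + 1) → Subset (m + 1)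
      bag t = ⁅ t ⁆ ∪ ⁅ c ⁆
      c∈bag : ∀ t → c ∈ bag t
      c∈bag t = x∈p∪q⁺ (inj₂ (x∈⁅x⁆ c))
      bag-not-forbidden : ∀ {v t} → v ∈ bag t → t ∉ ∁ (Vec.tabulate λ t′ → Vec.lookup (bag t′) v)
      bag-not-forbidden v∈ = x∈p⇒x∉∁p (∈-tabulate⁺ ([]=⇒lookup v∈))
      leaf-bag : ∀ {ℓ t} → leaf ℓ ∈ bag t → leaf ℓ ≡ t
      leaf-bag {ℓ} ℓ∈ with x∈p∪q⁻ _ _ ℓ∈
      ... | inj₁ ℓ∈⁅t⁆ = x∈⁅y⁆⇒x≡y _ ℓ∈⁅t⁆
      ... | inj₂ ℓ∈⁅c⁆ = contradiction (x∈⁅y⁆⇒x≡y _ ℓ∈⁅c⁆) (leaf≢centre ℓ)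
      decomposition : TreeDecomp S
      decomposition = record
        { T = S ; tree = star-is-tree ; B = bag
        ; vcover = λ v → v , x∈p∪q⁺ (inj₁ (x∈⁅x⁆ v))
        ; ecover = ecover ; conn = conn }
        where
          ecover : ∀ e → ∃ λ t → proj₁ (lookup (E S) e) ∈ bag t × proj₂ (lookup (E S) e) ∈ bag t
          ecover e with star-edge-is-spoke e
          ... | ℓ , eq rewrite eq = leaf ℓ , x∈p∪q⁺ (inj₁ (x∈⁅x⁆ _)) , c∈bag _
          conn : ∀ v a b → v ∈ bag a → v ∈ bag b → Reach S (∁ (Vec.tabulate λ t → Vec.lookup (bag t) v)) a b
          conn v a b v∈a v∈b with leaf-or-centre v
          ... | inj₁ refl = reach-via-centre (bag-not-forbidden v∈a) (bag-not-forbidden v∈b) (bag-not-forbidden (c∈bag c))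
          ... | inj₂ (ℓ , refl) with leaf-bag {t = a} v∈a | leaf-bag {t = b} v∈b
          ...   | refl | refl = here (bag-not-forbidden v∈a)

  star-decomposition : TreeCutDecomp S
  star-decomposition = record
    { T = S ; tree = star-is-tree ; X = ⁅_⁆ ; part = λ v → v , x∈⁅x⁆ v
    ; disj = λ _ b b′ v∈b v∈b′ → trans (sym (x∈⁅y⁆⇒x≡y b v∈b)) (x∈⁅y⁆⇒x≡y b′ v∈b′) }

  private
    D = star-decomposition

  star-adhesion : ∀ f → AdhLE D f 1
  star-adhesion f A crossing with star-edge-is-spoke f
  ... | ℓ , f≡ℓ = ℕ.≤-trans (p⊆q⇒∣p∣≤∣q∣ A⊆⁅f⁆) (∣⁅x⁆∣≤1 f)
    where
      A⊆⁅f⁆ : A ⊆ ⁅ f ⁆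
      A⊆⁅f⁆ {e} e∈A
        with subst (λ z → Crosses D (proj₁ z) (proj₂ z) (lookup (E S) e)) f≡ℓ (crossing e e∈A) | star-edge-is-spoke e
      ... | b₁ , _ , e₁∈b₁ , _ , inj₁ (ℓ⇝b₁ , _) | ℓ′ , e≡ℓ′ =
        subst (_∈ ⁅ f ⁆) (star-lookup-injective f e (trans f≡ℓ (trans (cong spoke (↑ˡ-injective 1 _ _ ℓ≡ℓ′)) (sym e≡ℓ′))))
              (x∈⁅x⁆ f)
        where
          ℓ≡ℓ′ : leaf ℓ ≡ leaf ℓ′
          ℓ≡ℓ′ = trans (sym (reach-avoiding-centre-trivial ℓ⇝b₁))
                       (trans (sym (x∈⁅y⁆⇒x≡y b₁ e₁∈b₁)) (cong proj₁ e≡ℓ′))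
      ... | _ , b₂ , _ , e₂∈b₂ , inj₂ (ℓ⇝b₂ , _) | ℓ′ , e≡ℓ′ =
        contradiction (trans (sym (reach-avoiding-centre-trivial ℓ⇝b₂))
                             (trans (sym (x∈⁅y⁆⇒x≡y b₂ e₂∈b₂)) (cong proj₂ e≡ℓ′)))
                      (leaf≢centre ℓ)

  private
    bag-vertex : Fin M → Fin (M + M)
    bag-vertex v = v ↑ˡ M
    consolidated : Fin M → Fin (M + M)
    consolidated u = M ↑ʳ u

    consolidation : Fin M → (Fin M → Fin (M + M)) → Fin M → Fin (M + M)
    consolidation t elsewhere v with v ≟ᶠ t
    ... | yes _ = bag-vertex v
    ... | no _ = elsewhere v

    consolidation-at : ∀ t elsewhere → consolidation t elsewhere t ≡ bag-vertex t
    consolidation-at t elsewhere with t ≟ᶠ t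
    ... | yes _ = refl
    ... | no t≢t = contradiction refl t≢t

    consolidation-elsewhere : ∀ t elsewhere {v} → v ≢ t → consolidation t elsewhere v ≡ elsewhere v
    consolidation-elsewhere t elsewhere {v} v≢t with v ≟ᶠ t
    ... | yes v≡t = contradiction v≡t v≢t
    ... | no _ = refl

    torso-protected≤1 : ∀ t → ∣ torsoProt D t ∣ ≤ 1
    torso-protected≤1 t = ℕ.≤-trans (p⊆q⇒∣p∣≤∣q∣ protected⊆) (∣⁅x⁆∣≤1 (bag-vertex t))
      where
        protected⊆ : torsoProt D t ⊆ ⁅ bag-vertex t ⁆
        protected⊆ x∈ with torsoProt⁻ D x∈
        ... | v , v∈⁅t⁆ , refl rewrite x∈⁅y⁆⇒x≡y t v∈⁅t⁆ = x∈⁅x⁆ _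

  private
    centre-edge : Fin m → Fin (M + M) × Fin (M + M)
    centre-edge ℓ = consolidated (leaf ℓ) , bag-vertex c

    centre-torso-edges : ∀ xs → torsoE D c (consolidation c consolidated) (map spoke xs) ≡ map centre-edge xs
    centre-torso-edges [] = refl
    centre-torso-edges (ℓ ∷ xs)
      rewrite lookup-⁅x⁆-y (leaf≢centre ℓ) | lookup-⁅x⁆-x c
            | consolidation-elsewhere c consolidated (leaf≢centre ℓ) | consolidation-at c consolidated =
      cong (centre-edge ℓ ∷_) (centre-torso-edges xs)

    strip-leaves : ∀ {thr} → 1 ≤ thr → ∀ xs al → Unique xs → (∀ {ℓ} → ℓ ∈ₗ xs → consolidated (leaf ℓ) ∈ al) →
                   ∃ λ al′ → Star (Supp thr (torsoProt D c)) (st al (map centre-edge xs)) (st al′ [])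
    strip-leaves 1≤thr [] al _ _ = al , ε
    strip-leaves 1≤thr (ℓ ∷ xs) al (ℓ∉xs ∷ xs-unique) alive
      with strip-leaves 1≤thr xs (al - consolidated (leaf ℓ)) xs-unique still-alive
      where
        still-alive : ∀ {ℓ′} → ℓ′ ∈ₗ xs → consolidated (leaf ℓ′) ∈ al - consolidated (leaf ℓ)
        still-alive ℓ′∈xs = x∈p∧x∉q⇒x∈p─q (alive (there ℓ′∈xs))
          (∉⁅⁆ λ eq → All.lookup ℓ∉xs ℓ′∈xs (sym (↑ˡ-injective 1 _ _ (↑ʳ-injective M _ _ eq))))
    ... | al′ , supps =
      al′ , deg1 1≤thr (alive (here refl)) (consolidated∉torsoProt D {c} _) ↭-refl (inj₁ (refl , refl))
                 (↑ˡ≢↑ʳ c _) (untouched xs ℓ∉xs) ◅ supps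
      where
        untouched : ∀ ys → All (ℓ ≢_) ys → NotInc (consolidated (leaf ℓ)) (map centre-edge ys)
        untouched [] [] = []
        untouched (y ∷ ys) (ℓ≢y ∷ ℓ∉ys) =
          [ (λ eq → ℓ≢y (sym (↑ˡ-injective 1 _ _ (↑ʳ-injective M _ _ eq)))) , ↑ˡ≢↑ʳ c _ ] ∷ untouched ys ℓ∉ys

    centre-consolidation : IsConsol D c (consolidation c consolidated)
    centre-consolidation v = at-c , elsewhere
      where
        at-c : v ∈ ⁅ c ⁆ → consolidation c consolidated v ≡ bag-vertex v
        at-c v∈⁅c⁆ rewrite x∈⁅y⁆⇒x≡y c v∈⁅c⁆ = consolidation-at c consolidated
        elsewhere : ∀ b → v ∈ ⁅ b ⁆ → b ≢ c →
                    ∃ λ u → AdjT D c u × Reach S ⁅ c ⁆ u b × consolidation c consolidated v ≡ consolidated u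
        elsewhere b v∈⁅b⁆ b≢c with x∈⁅y⁆⇒x≡y b v∈⁅b⁆ | leaf-or-centre b
        ... | refl | inj₁ b≡c = contradiction b≡c b≢c
        ... | refl | inj₂ (ℓ , refl) = leaf ℓ , (proj₁ (spoke-edge ℓ) , joins-sym (proj₂ (spoke-edge ℓ))) ,
                                       here (∉⁅⁆ b≢c) , consolidation-elsewhere c consolidated b≢c

  centre-torso : ∀ {thr} → 1 ≤ thr → TorLE D thr c 1
  centre-torso {thr} 1≤thr = consolidation c consolidated , centre-consolidation ,
    CenterLE-from-edgeless (subst (λ es → Star (Supp thr (torsoProt D c)) (st (torsoAlive D c) es) (st (proj₁ stripped) []))
                                      (sym (centre-torso-edges (allFin m))) (proj₂ stripped))
                               (torso-protected≤1 c)
    where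
      stripped = strip-leaves 1≤thr (allFin m) (torsoAlive D c) (allFin⁺ m)
                   (λ {ℓ} _ → neighbour∈torsoAlive D (proj₁ (spoke-edge ℓ) , joins-sym (proj₂ (spoke-edge ℓ))))

  module _ (ℓ₀ : Fin m) where
    private
      t = leaf ℓ₀
      φ : Fin M → Fin (M + M)
      φ = consolidation t (λ _ → consolidated c)

      c≢t : c ≢ t
      c≢t = leaf≢centre ℓ₀ ∘ sym

      other-spoke-vanishes : ∀ {ℓ} es → ℓ ≢ ℓ₀ → torsoE D t φ (spoke ℓ ∷ es) ≡ torsoE D t φ es
      other-spoke-vanishes {ℓ} es ℓ≢ℓ₀
        rewrite lookup-⁅x⁆-y {x = t} (ℓ≢ℓ₀ ∘ ↑ˡ-injective 1 _ _) | lookup-⁅x⁆-y c≢t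
              | consolidation-elsewhere t (λ _ → consolidated c) (ℓ≢ℓ₀ ∘ ↑ˡ-injective 1 _ _)
              | consolidation-elsewhere t (λ _ → consolidated c) c≢t | ⌊x≟x⌋ (consolidated c) = refl

      others-vanish : ∀ xs → All (ℓ₀ ≢_) xs → torsoE D t φ (map spoke xs) ≡ []
      others-vanish [] [] = refl
      others-vanish (ℓ ∷ xs) (ℓ₀≢ℓ ∷ ℓ₀∉xs) =
        trans (other-spoke-vanishes (map spoke xs) (ℓ₀≢ℓ ∘ sym)) (others-vanish xs ℓ₀∉xs)

      leaf-torso-edges : ∀ xs → Unique xs → ℓ₀ ∈ₗ xs → torsoE D t φ (map spoke xs) ≡ (bag-vertex t , consolidated c) ∷ []
      leaf-torso-edges (ℓ ∷ xs) (ℓ∉xs ∷ xs-unique) ℓ₀∈ with ℓ ≟ᶠ ℓ₀ | ℓ₀∈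
      ... | yes refl | _ rewrite lookup-⁅x⁆-x t | consolidation-at t (λ _ → consolidated c)
                               | consolidation-elsewhere t (λ _ → consolidated c) c≢t = cong (_ ∷_) (others-vanish xs ℓ∉xs)
      ... | no ℓ≢ℓ₀ | here ℓ₀≡ℓ = contradiction (sym ℓ₀≡ℓ) ℓ≢ℓ₀
      ... | no ℓ≢ℓ₀ | there ℓ₀∈xs =
        trans (other-spoke-vanishes (map spoke xs) ℓ≢ℓ₀) (leaf-torso-edges xs xs-unique ℓ₀∈xs)

      leaf-consolidation : IsConsol D t φ
      leaf-consolidation v = at-t , elsewhere
        where
          at-t : v ∈ ⁅ t ⁆ → φ v ≡ bag-vertex v
          at-t v∈⁅t⁆ rewrite x∈⁅y⁆⇒x≡y t v∈⁅t⁆ = consolidation-at t (λ _ → consolidated c)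
          elsewhere : ∀ b → v ∈ ⁅ b ⁆ → b ≢ t → ∃ λ u → AdjT D t u × Reach S ⁅ t ⁆ u b × φ v ≡ consolidated u
          elsewhere b v∈⁅b⁆ b≢t with x∈⁅y⁆⇒x≡y b v∈⁅b⁆
          ... | refl = c , spoke-edge ℓ₀ , reach-sym (reach-centre (∉⁅⁆ b≢t) (∉⁅⁆ c≢t)) ,
                       consolidation-elsewhere t (λ _ → consolidated c) b≢t

    leaf-torso : ∀ {thr} → 1 ≤ thr → TorLE D thr t 1
    leaf-torso {thr} 1≤thr = φ , leaf-consolidation ,
      CenterLE-from-edgeless
        (subst (λ es → Star (Supp thr (torsoProt D t)) (st (torsoAlive D t) es) (st (torsoAlive D t - consolidated c) []))
               (sym (leaf-torso-edges (allFin m) (allFin⁺ m) (∈-allFin ℓ₀)))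
               (deg1 1≤thr (neighbour∈torsoAlive D (spoke-edge ℓ₀)) (consolidated∉torsoProt D {t} c) ↭-refl
                     (inj₂ (refl , refl)) (↑ˡ≢↑ʳ t c) [] ◅ ε))
        (torso-protected≤1 t)

  TCWthr≤-star : ∀ {thr} → 1 ≤ thr → TCWthr≤ thr S 1
  TCWthr≤-star 1≤thr = D , star-adhesion , torso
    where
      torso : ∀ t → TorLE D _ t 1
      torso t with leaf-or-centre t
      ... | inj₁ refl = centre-torso 1≤thr
      ... | inj₂ (ℓ , refl) = leaf-torso ℓ 1≤thr

clique-size : Param → ℕ → ℕ
clique-size tw c = 2 + c
clique-size fvs c = 3 + c
clique-size fn c = suc c + suc c
clique-size vc c = 2 + c
clique-size tcw c = 2 + c
clique-size stcw c = 2 + c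
clique-size fen c = 3 + c

complete-unbounded : ∀ κ c → ¬ (complete (clique-size κ c) ≤ₚ c at κ)
complete-unbounded tw = ¬TW≤-complete
complete-unbounded fvs = ¬FVS≤-complete
complete-unbounded fn = ¬FN≤-complete
complete-unbounded vc = ¬VC≤-complete
complete-unbounded tcw = ¬TCWthr≤-complete 2
complete-unbounded stcw = ¬TCWthr≤-complete 1
complete-unbounded fen = ¬FEN≤-complete

star-bounded : ∀ κ → ∃ λ c → ∀ m → star m ≤ₚ c at κ
star-bounded tw = 1 , λ _ → TW≤-star
star-bounded fvs = 0 , λ _ → FVS≤-star
star-bounded fn = 1 , λ _ → FN≤-star
star-bounded vc = 1 , λ _ → VC≤-star
star-bounded tcw = 1 , λ _ → TCWthr≤-star (s≤s z≤n)
star-bounded stcw = 1 , λ _ → TCWthr≤-star (s≤s z≤n)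
star-bounded fen = 0 , λ _ → FEN≤-star

lemma3p3 : (κ : Param) → Σ (ℕ → Instance) λ F →
    (∃ λ c → ∀ i → vertAug (F i) ≤ₚ c at κ) ×
    (∀ c → ∃ λ i → ¬ (cliqueAug (F i) ≤ₚ c at κ))
lemma3p3 κ with star-bounded κ
... | c , bounded =
  edgeless-instance ∘ clique-size κ ,
  (c , λ i → subst (_≤ₚ c at κ) (sym (vertAug-edgeless≡star _)) (bounded _)) ,
  λ c′ → c′ , complete-unbounded κ c′
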